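{- Let $\mathit{Atm}_0$ be infinite. Then the logic $\mathsf{D\text{ - }WPLC}$ is sound and complete relative to the class $\mathbf{MCM}$: a formula of $\mathcal{L}^{\mathit{dyn}}$ is a theorem of $\mathsf{D\text{ - }WPLC}$ if and only if it is valid in every multi-classifier model.
   Context: Let $\mathit{Atm}_0$ be a countable set of atomic propositions and $\mathit{Val}$ a finite set of output values; decision atoms $\mathsf{t}(x)$ for $x\in\mathit{Val}$. Language $\mathcal{L}^{\mathit{dyn}}$: $\varphi ::= p \mid \mathsf{t}(x)\mid \neg\varphi\mid \varphi\wedge\varphi\mid \Box_{\mathtt{I}}\varphi\mid \Box_{\mathtt{F}}\varphi\mid[\varphi]\psi$ ($p\in\mathit{Atm}_0$, $x\in\mathit{Val}$). A multi-classifier model (MCM) is a pair $\Gamma=(S,\Phi)$ with $S\subseteq 2^{\mathit{Atm}_0}$ and $\Phi$ a set of functions from $S$ to $\mathit{Val}$. For $s\in S$, $f\in\Phi$: $(\Gamma,s,f)\models p$ iff $p\in s$; $(\Gamma,s,f)\models\mathsf{t}(x)$ iff $f(s)=x$; Boolean connectives as usual; $(\Gamma,s,f)\models\Box_{\mathtt{I}}\varphi$ iff $(\Gamma,s',f)\models\varphi$ for all $s'\in S$; $(\Gamma,s,f)\models\Box_{\mathtt{F}}\varphi$ iff $(\Gamma,s,f')\models\varphi$ for all $f'\in\Phi$; $(\Gamma,s,f)\models[\varphi]\psi$ iff, if $(\Gamma,s,f)\models\Box_{\mathtt{I}}\varphi$ then $(\Gamma^\varphi,s,f)\models\psi$, where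 $\Gamma^\varphi=(S,\Phi^\varphi)$ with $\Phi^\varphi=\{f'\in\Phi:\forall s'\in S,\ (\Gamma,s',f')\models\varphi\}$. The logic $\mathsf{WPLC}$ is classical propositional logic plus, with $\blacksquare\in\{\Box_{\mathtt{I}},\Box_{\mathtt{F}}\}$: K: $(\blacksquare\varphi\wedge\blacksquare(\varphi\to\psi))\to\blacksquare\psi$; T: $\blacksquare\varphi\to\varphi$; 4: $\blacksquare\varphi\to\blacksquare\blacksquare\varphi$; 5: $\neg\blacksquare\varphi\to\blacksquare\neg\blacksquare\varphi$; Comm: $\Box_{\mathtt{F}}\Box_{\mathtt{I}}\varphi\leftrightarrow\Box_{\mathtt{I}}\Box_{\mathtt{F}}\varphi$; AtLeast: $\bigvee_{x\in\mathit{Val}}\mathsf{t}(x)$; AtMost: $\mathsf{t}(x)\to\neg\mathsf{t}(y)$ for $x\neq y$; Indep: $p\to\Box_{\mathtt{F}}p$, $\neg p\to\Box_{\mathtt{F}}\neg p$ for $p\in\mathit{Atm}_0$; Nec: from $\varphi$ infer $\blacksquare\varphi$. The logic $\mathsf{D\text{ - }WPLC}$ extends $\mathsf{WPLC}$ (over $\mathcal{L}^{\mathit{dyn}}$) by the reduction axioms $[\varphi]p\leftrightarrow(\Box_{\mathtt{I}}\varphi\to p)$; $[\varphi]\mathsf{t}(x)\leftrightarrow(\Box_{\mathtt{I}}\varphi\to\mathsf{t}(x))$; $[\varphi]\neg\psi\leftrightarrow(\Box_{\mathtt{I}}\varphi\to\neg[\varphi]\psi)$; $[\varphi](\psi_1\wedge\psi_2)\leftrightarrow([\varphi]\psi_1\wedge[\varphi]\psi_2)$;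 $[\varphi]\Box_{\mathtt{I}}\psi\leftrightarrow(\Box_{\mathtt{I}}\varphi\to\Box_{\mathtt{I}}[\varphi]\psi)$; $[\varphi]\Box_{\mathtt{F}}\psi\leftrightarrow(\Box_{\mathtt{I}}\varphi\to\Box_{\mathtt{F}}[\varphi]\psi)$, and the rule of replacement of equivalents: from $\varphi_1\leftrightarrow\varphi_2$ infer $\psi\leftrightarrow\psi[\varphi_1/\varphi_2]$. -}

module Defs where

open import Level using (Level)
open import Data.Nat using (ℕ)
open import Data.Fin using (Fin)
open import Data.Bool using (Bool; true; false; not; _∧_; T)
open import Data.List using (List; []; _∷_; foldr)
open import Data.Fin.Base using ()
open import Data.Product using (_×_; Σ)
open import Relation.Binary.PropositionalEquality using (_≡_; _≢_)
open import Relation.Nullary using (¬_)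
open import Axiom.ExcludedMiddle using (ExcludedMiddle)
open import Function.Bundles using (_⇔_)

import Data.List as L
import Data.Fin as F

-- Syntax of L^dyn.  Atm₀ = ℕ (a countably infinite set of atoms),
-- Val = Fin k (an arbitrary finite set of output values).

infix 8 ¬ᶠ_
infixr 6 _∧ᶠ_

data Fm (k : ℕ) : Set where
  atm   : ℕ → Fm k
  dec   : Fin k → Fm k
  ¬ᶠ_   : Fm k → Fm k
  _∧ᶠ_  : Fm k → Fm k → Fm k
  □I    : Fm k → Fm k
  □F    : Fm k → Fm k
  [_]_  : Fm k → Fm k → Fm k

module _ {k : ℕ} where

  infixr 5 _∨ᶠ_
  infixr 4 _⇒_
  infix 3 _⇔ᶠ_
  infix 1 ⊢_

  _∨ᶠ_ : Fm k → Fm k → Fm k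
  φ ∨ᶠ ψ = ¬ᶠ (¬ᶠ φ ∧ᶠ ¬ᶠ ψ)

  _⇒_ : Fm k → Fm k → Fm k
  φ ⇒ ψ = ¬ᶠ (φ ∧ᶠ ¬ᶠ ψ)

  _⇔ᶠ_ : Fm k → Fm k → Fm k
  φ ⇔ᶠ ψ = (φ ⇒ ψ) ∧ᶠ (ψ ⇒ φ)

  ⊤ᶠ : Fm k
  ⊤ᶠ = ¬ᶠ (atm 0 ∧ᶠ ¬ᶠ atm 0)

  ⊥ᶠ : Fm k
  ⊥ᶠ = ¬ᶠ ⊤ᶠ

  atLeast : Fm k
  atLeast = foldr (λ x φ → dec x ∨ᶠ φ) ⊥ᶠ (L.allFin k)

  -- A formula is a tautology if it is true
  -- under every Boolean assignment to its non-Boolean (atomic, modal,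
  -- dynamic) subformulas, with ¬ and ∧ read truth-functionally.

  evalB : (Fm k → Bool) → Fm k → Bool
  evalB v (¬ᶠ φ)   = not (evalB v φ)
  evalB v (φ ∧ᶠ ψ) = evalB v φ ∧ evalB v ψ
  evalB v φ        = v φ

  Tautology : Fm k → Set
  Tautology φ = (v : Fm k → Bool) → evalB v φ ≡ true

  data Ctx : Set where
    hole  : Ctx
    ¬c    : Ctx → Ctx
    ∧l    : Ctx → Fm k → Ctx
    ∧r    : Fm k → Ctx → Ctx
    □Ic   : Ctx → Ctx
    □Fc   : Ctx → Ctx
    annl  : Ctx → Fm k → Ctx
    annr  : Fm k → Ctx → Ctx

  plug : Ctx → Fm k → Fm k
  plug hole       χ = χ
  plug (¬c C)     χ = ¬ᶠ plug C χ
  plug (∧l C ψ)   χ = plug C χ ∧ᶠ ψ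
  plug (∧r φ C)   χ = φ ∧ᶠ plug C χ
  plug (□Ic C)    χ = □I (plug C χ)
  plug (□Fc C)    χ = □F (plug C χ)
  plug (annl C ψ) χ = [ plug C χ ] ψ
  plug (annr φ C) χ = [ φ ] plug C χ

  data ⊢_ : Fm k → Set where
    taut   : ∀ {φ} → Tautology φ → ⊢ φ
    mp     : ∀ {φ ψ} → ⊢ φ → ⊢ (φ ⇒ ψ) → ⊢ ψ
    K-I    : ∀ φ ψ → ⊢ ((□I φ ∧ᶠ □I (φ ⇒ ψ)) ⇒ □I ψ)
    T-I    : ∀ φ → ⊢ (□I φ ⇒ φ)
    4-I    : ∀ φ → ⊢ (□I φ ⇒ □I (□I φ))
    5-I    : ∀ φ → ⊢ (¬ᶠ □I φ ⇒ □I (¬ᶠ □I φ))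
    nec-I  : ∀ {φ} → ⊢ φ → ⊢ □I φ
    K-F    : ∀ φ ψ → ⊢ ((□F φ ∧ᶠ □F (φ ⇒ ψ)) ⇒ □F ψ)
    T-F    : ∀ φ → ⊢ (□F φ ⇒ φ)
    4-F    : ∀ φ → ⊢ (□F φ ⇒ □F (□F φ))
    5-F    : ∀ φ → ⊢ (¬ᶠ □F φ ⇒ □F (¬ᶠ □F φ))
    nec-F  : ∀ {φ} → ⊢ φ → ⊢ □F φ
    comm   : ∀ φ → ⊢ (□F (□I φ) ⇔ᶠ □I (□F φ))
    atleast : ⊢ atLeast
    atmost : ∀ x y → x ≢ y → ⊢ (dec x ⇒ ¬ᶠ dec y)
    indep+ : ∀ p → ⊢ (atm p ⇒ □F (atm p))
    indep- : ∀ p → ⊢ (¬ᶠ atm p ⇒ □F (¬ᶠ atm p))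
    red-atm : ∀ φ p → ⊢ (([ φ ] atm p) ⇔ᶠ (□I φ ⇒ atm p))
    red-dec : ∀ φ x → ⊢ (([ φ ] dec x) ⇔ᶠ (□I φ ⇒ dec x))
    red-¬   : ∀ φ ψ → ⊢ (([ φ ] (¬ᶠ ψ)) ⇔ᶠ (□I φ ⇒ ¬ᶠ ([ φ ] ψ)))
    red-∧   : ∀ φ ψ₁ ψ₂ → ⊢ (([ φ ] (ψ₁ ∧ᶠ ψ₂)) ⇔ᶠ (([ φ ] ψ₁) ∧ᶠ ([ φ ] ψ₂)))
    red-□I  : ∀ φ ψ → ⊢ (([ φ ] □I ψ) ⇔ᶠ (□I φ ⇒ □I ([ φ ] ψ)))
    red-□F  : ∀ φ ψ → ⊢ (([ φ ] □F ψ) ⇔ᶠ (□I φ ⇒ □F ([ φ ] ψ)))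
    repl    : ∀ {φ₁ φ₂} (C : Ctx) → ⊢ (φ₁ ⇔ᶠ φ₂) → ⊢ (plug C φ₁ ⇔ᶠ plug C φ₂)

-- A state is a valuation s ⊆ Atm₀, represented as ℕ → Bool.
-- S ⊆ 2^Atm₀ is given by its characteristic function; a classifier is a
-- function from S to Val, i.e. from states s with s ∈ S to Fin k.
-- Since states are functions, classifiers in Φ are required to respect
-- pointwise equality of states (so they are genuinely functions on
-- subsets of Atm₀).

State : Set
State = ℕ → Bool

record MCM (k : ℕ) : Set₁ where
  field
    S   : State → Bool
    Φ   : ((s : State) → T (S s) → Fin k) → Set
    ext : ∀ f → Φ f → ∀ s s' (m : T (S s)) (m' : T (S s')) →
          (∀ n → s n ≡ s' n) → f s m ≡ f s' m'

Classifier : {k : ℕ} → MCM k → Set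
Classifier {k} Γ = (s : State) → T (MCM.S Γ s) → Fin k

-- (Γ, s, f) ⊨ φ, defined on the components (S, Φ) of Γ; the update
-- Γ^φ = (S, Φ^φ) leaves S unchanged and restricts Φ.
satSΦ : ∀ {k} (S : State → Bool) (Φ : ((s : State) → T (S s) → Fin k) → Set)
        (s : State) → T (S s) → ((s : State) → T (S s) → Fin k) → Fm k → Set
satSΦ S Φ s m f (atm p)   = s p ≡ true
satSΦ S Φ s m f (dec x)   = f s m ≡ x
satSΦ S Φ s m f (¬ᶠ φ)    = ¬ satSΦ S Φ s m f φ
satSΦ S Φ s m f (φ ∧ᶠ ψ)  = satSΦ S Φ s m f φ × satSΦ S Φ s m f ψ
satSΦ S Φ s m f (□I φ)    = ∀ s' (m' : T (S s')) → satSΦ S Φ s' m' f φ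
satSΦ S Φ s m f (□F φ)    = ∀ f' → Φ f' → satSΦ S Φ s m f' φ
satSΦ S Φ s m f ([ φ ] ψ) =
  (∀ s' (m' : T (S s')) → satSΦ S Φ s' m' f φ) →
  satSΦ S (λ f' → Φ f' × (∀ s' (m' : T (S s')) → satSΦ S Φ s' m' f' φ)) s m f ψ

sat : ∀ {k} (Γ : MCM k) (s : State) → T (MCM.S Γ s) → Classifier Γ → Fm k → Set
sat Γ = satSΦ (MCM.S Γ) (MCM.Φ Γ)

update : ∀ {k} → MCM k → Fm k → MCM k
update Γ φ = record
  { S   = MCM.S Γ
  ; Φ   = λ f' → MCM.Φ Γ f' × (∀ s' (m' : T (MCM.S Γ s')) → sat Γ s' m' f' φ)
  ; ext = λ f' p → MCM.ext Γ f' (Data.Product.proj₁ p)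
  }

Valid : ∀ {k} → Fm k → Set₁
Valid {k} φ = (Γ : MCM k) (s : State) (m : T (MCM.S Γ s)) (f : Classifier Γ) →
              MCM.Φ Γ f → sat Γ s m f φ

{-# OPTIONS --safe #-}
module Submission where

-- Soundness: each axiom and rule is checked directly; with excluded middle,
-- satisfaction at a point is a classical valuation, so tautologies hold.
--
-- Completeness: the reduction axioms and replacement of equivalents turn every
-- formula into a provably equivalent static one, so it suffices to falsify an
-- unprovable static ψ.  Extend {¬ψ} to a maximal consistent set w₀ and consider
-- the maximal consistent sets reachable from w₀ along ~I and then ~F, where ~X
-- relates sets that agree on all □X-formulas.  Both relations are equivalences
-- by S5, and Comm makes them commute, so any two reachable sets a and c are
-- joined by a set m with a ~F m ~I c.  A state stores a reachable set a in the
-- atoms that do not occur in ψ (this is where infinitely many atoms are needed)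
-- and agrees with a on the atoms of ψ; a classifier stores a reachable set c and
-- outputs, at such a state, the value recorded in such an m.  Indep keeps atoms
-- constant along ~F and AtLeast/AtMost make the output well defined, so a truth
-- lemma holds, and ψ fails where both the state and the classifier store w₀.

open import Defs
open import Level using (0ℓ)
open import Axiom.ExcludedMiddle using (ExcludedMiddle)
open import Data.Bool using (Bool; true; false; not; _∧_; T; if_then_else_)
open import Data.Bool.Properties using (T-≡; T-not-≡; T-∧; not-¬; _≟_)
open import Data.Empty using (⊥; ⊥-elim)
open import Data.Fin using (Fin; toℕ; fromℕ<)
open import Data.Fin.Properties using (fromℕ<-toℕ; toℕ<n)
import Data.Fin.Properties as Fin
open import Data.Nat using (ℕ; zero; suc; _+_; _∸_; _⊔_; _<_; _≤_; s≤s; _<?_; _<ᵇ_)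
open import Data.Nat.Properties
  using (+-comm; +-identityʳ; +-suc; ≤-<-trans; ≤-trans; m≤m⊔n; m≤n⊔m; ≤-refl; m≤m+n; <⇒≱; m+n∸m≡n; <⇒<ᵇ; <ᵇ⇒<)
open import Data.List using (List; []; _∷_; _++_; foldr; allFin)
open import Data.List.Relation.Unary.All using (All; []; _∷_)
import Data.List.Relation.Unary.All as All
open import Data.List.Relation.Unary.All.Properties using (++⁺; ++⁻)
open import Data.List.Membership.Propositional using (_∈_)
open import Data.List.Membership.Propositional.Properties using (∈-allFin)
open import Data.List.Relation.Unary.Any using (Any; here; there)
import Data.List.Relation.Unary.Any as Any
open import Data.Product using (Σ; _×_; _,_; proj₁; proj₂)
open import Data.Product.Function.NonDependent.Propositional using (_×-⇔_)
open import Data.Sum using (_⊎_; inj₁; inj₂)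
open import Data.Sum.Function.Propositional using (_⊎-⇔_)
open import Data.Unit using (⊤; tt)
open import Function using (_∘_; id; case_of_)
open import Function.Bundles using (_⇔_; mk⇔; module Equivalence)
import Function.Properties.Equivalence as ⇔
open import Function.Related.TypeIsomorphisms using (¬-cong-⇔; →-cong-⇔)
open import Relation.Binary.PropositionalEquality
  using (_≡_; _≗_; refl; sym; trans; cong; cong₂; cong-app; subst)
open import Relation.Nullary using (¬_; Dec; yes; no; does)
open import Relation.Nullary.Decidable
  using (T?; decidable-stable; does-⇔; map′; dec-true; dec-false)

open Equivalence using (to; from)

private variable
  k : ℕ
  φ ψ χ φ′ ψ′ φ₁ φ₂ : Fm k
  v : Fm k → Bool
  A B : Set

Π-⇔ : ∀ {I : Set} {P Q : I → Set} → (∀ i → P i ⇔ Q i) → (∀ i → P i) ⇔ (∀ i → Q i)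
Π-⇔ P⇔Q = mk⇔ (λ p i → to (P⇔Q i) (p i)) (λ q i → from (P⇔Q i) (q i))

if-dec : ∀ {C : Set} (R : C → Set) (d : Dec A) {x y} → (A → R x) → (¬ A → R y) →
         R (if does d then x else y)
if-dec R (yes a) Rx _ = Rx a
if-dec R (no ¬a) _ Ry = Ry ¬a

if-cong : ∀ {C D : Set} {b b′} {x x′ y y′ : C → D} → b ≡ b′ → x ≗ x′ → y ≗ y′ →
          (if b then x else y) ≗ (if b′ then x′ else y′)
if-cong {b = true}  refl x≗x′ _ = x≗x′
if-cong {b = false} refl _ y≗y′ = y≗y′

infix 4 _⊨_

-- A record rather than T (evalB v φ), so that v and φ can be inferred.
record _⊨_ (v : Fm k → Bool) (φ : Fm k) : Set where
  constructor ⊨-intro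
  field ⊨-elim : T (evalB v φ)
open _⊨_

T-not : ∀ {b} → T (not b) ⇔ (¬ T b)
T-not {false} = mk⇔ (λ _ ()) (λ _ → tt)
T-not {true}  = mk⇔ (λ ()) (λ ¬tt → ¬tt tt)

T-⇒ : ∀ a b → T (not (a ∧ not b)) ⇔ (T a → T b)
T-⇒ true  true  = mk⇔ (λ _ _ → tt) (λ _ → tt)
T-⇒ true  false = mk⇔ (λ ()) (λ ab → ab tt)
T-⇒ false _     = mk⇔ (λ _ ()) (λ _ → tt)

⊨-¬ : v ⊨ ¬ᶠ φ ⇔ (¬ v ⊨ φ)
⊨-¬ = mk⇔ (λ ⊨¬φ ⊨φ → to T-not (⊨-elim ⊨¬φ) (⊨-elim ⊨φ))
          (λ ⊭φ → ⊨-intro (from T-not (⊭φ ∘ ⊨-intro)))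

⊨-∧ : v ⊨ φ ∧ᶠ ψ ⇔ (v ⊨ φ × v ⊨ ψ)
⊨-∧ = mk⇔ (λ (⊨-intro ⊨φψ) → ⊨-intro (proj₁ (to T-∧ ⊨φψ)) , ⊨-intro (proj₂ (to T-∧ ⊨φψ)))
          (λ (⊨φ , ⊨ψ) → ⊨-intro (from T-∧ (⊨-elim ⊨φ , ⊨-elim ⊨ψ)))

⊨-⇒ : v ⊨ (φ ⇒ ψ) ⇔ (v ⊨ φ → v ⊨ ψ)
⊨-⇒ {v = v} {φ = φ} {ψ = ψ} = mk⇔
  (λ ⊨φ⇒ψ ⊨φ → ⊨-intro (to (T-⇒ (evalB v φ) (evalB v ψ)) (⊨-elim ⊨φ⇒ψ) (⊨-elim ⊨φ)))
  (λ φ⇒ψ → ⊨-intro (from (T-⇒ (evalB v φ) (evalB v ψ)) (⊨-elim ∘ φ⇒ψ ∘ ⊨-intro)))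

⊨-⇔ : v ⊨ (φ ⇔ᶠ ψ) ⇔ (v ⊨ φ ⇔ v ⊨ ψ)
⊨-⇔ = mk⇔ (λ ⊨φ⇔ψ → let (φ⇒ψ , ψ⇒φ) = to ⊨-∧ ⊨φ⇔ψ in mk⇔ (to ⊨-⇒ φ⇒ψ) (to ⊨-⇒ ψ⇒φ))
          (λ φ⇔ψ → from ⊨-∧ (from ⊨-⇒ (to φ⇔ψ) , from ⊨-⇒ (from φ⇔ψ)))

⊨-⊤ : v ⊨ ⊤ᶠ {k}
⊨-⊤ = from ⊨-⇒ id

_⊨?_ : ∀ v (φ : Fm k) → Dec (v ⊨ φ)
v ⊨? φ = map′ ⊨-intro ⊨-elim (T? (evalB v φ))

⊨-stable : ¬ ¬ v ⊨ φ → v ⊨ φ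
⊨-stable {v = v} {φ = φ} ¬¬⊨φ =
  ⊨-intro (decidable-stable (T? (evalB v φ)) λ ¬T → ¬¬⊨φ (¬T ∘ ⊨-elim))

⊨-⋁ : ∀ (xs : List (Fin k)) → v ⊨ foldr (λ x φ → dec x ∨ᶠ φ) ⊥ᶠ xs →
      Any (λ x → v ⊨ dec x) xs
⊨-⋁ [] ⊨⊥ = ⊥-elim (to ⊨-¬ ⊨⊥ ⊨-⊤)
⊨-⋁ {v = v} (x ∷ xs) ⊨∨ with T? (v (dec x))
... | yes ⊨x = here (⊨-intro ⊨x)
... | no ⊭x  = there (⊨-⋁ xs (⊨-stable λ ⊭xs →
  to ⊨-¬ ⊨∨ (from ⊨-∧ (from ⊨-¬ (⊭x ∘ ⊨-elim) , from ⊨-¬ ⊭xs))))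

⋀ : List (Fm k) → Fm k
⋀ []      = ⊤ᶠ
⋀ (φ ∷ L) = φ ∧ᶠ ⋀ L

⊨-⋀ : ∀ {L : List (Fm k)} → v ⊨ ⋀ L ⇔ All (v ⊨_) L
⊨-⋀ {L = []}    = mk⇔ (λ _ → []) (λ _ → ⊨-⊤)
⊨-⋀ {L = φ ∷ L} =
  ⇔.trans ⊨-∧ (mk⇔ (λ (⊨φ , ⊨L) → ⊨φ ∷ to ⊨-⋀ ⊨L) (λ { (⊨φ ∷ ⊨L) → ⊨φ , from ⊨-⋀ ⊨L }))

record RespectsConnectives (P : Fm k → Set) : Set where
  field
    ¬-respected : P (¬ᶠ φ) ⇔ (¬ P φ)
    ∧-respected : P (φ ∧ᶠ ψ) ⇔ (P φ × P ψ)

⊨-faithful : ∀ {P : Fm k → Set} → RespectsConnectives P → (∀ φ → T (v φ) ⇔ P φ) →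
             ∀ φ → v ⊨ φ ⇔ P φ
⊨-faithful {v = v} {P = P} resp v⇔P = go
  where
  open RespectsConnectives resp
  leaf : ∀ {φ} → v ⊨ φ ⇔ T (v φ) → v ⊨ φ ⇔ P φ
  leaf e = ⇔.trans e (v⇔P _)
  go : ∀ φ → v ⊨ φ ⇔ P φ
  go (¬ᶠ φ)   = ⇔.trans ⊨-¬ (⇔.trans (¬-cong-⇔ (go φ)) (⇔.sym ¬-respected))
  go (φ ∧ᶠ ψ) = ⇔.trans ⊨-∧ (⇔.trans (go φ ×-⇔ go ψ) (⇔.sym ∧-respected))
  go (atm _)   = leaf (mk⇔ ⊨-elim ⊨-intro)
  go (dec _)   = leaf (mk⇔ ⊨-elim ⊨-intro)
  go (□I _)    = leaf (mk⇔ ⊨-elim ⊨-intro)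
  go (□F _)    = leaf (mk⇔ ⊨-elim ⊨-intro)
  go ([ _ ] _) = leaf (mk⇔ ⊨-elim ⊨-intro)

⊢-tautology : (∀ v → v ⊨ φ) → ⊢ φ
⊢-tautology ⊨φ = taut (λ v → to T-≡ (⊨-elim (⊨φ v)))

⊢-consequence : ⊢ φ → (∀ v → v ⊨ φ → v ⊨ ψ) → ⊢ ψ
⊢-consequence ⊢φ φ⊨ψ = mp ⊢φ (⊢-tautology λ v → from ⊨-⇒ (φ⊨ψ v))

⊢-consequence₂ : ⊢ φ → ⊢ ψ → (∀ v → v ⊨ φ → v ⊨ ψ → v ⊨ χ) → ⊢ χ
⊢-consequence₂ ⊢φ ⊢ψ φψ⊨χ = mp ⊢ψ (⊢-consequence ⊢φ λ v ⊨φ → from ⊨-⇒ (φψ⊨χ v ⊨φ))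

⊢-consequences : ∀ {L} → All ⊢_ L → (∀ v → All (v ⊨_) L → v ⊨ φ) → ⊢ φ
⊢-consequences ⊢L L⊨φ = ⊢-consequence (⊢⋀ ⊢L) λ v → L⊨φ v ∘ to ⊨-⋀
  where
  ⊢⋀ : ∀ {L} → All ⊢_ L → ⊢ ⋀ L
  ⊢⋀ []         = ⊢-tautology λ _ → ⊨-⊤
  ⊢⋀ (⊢φ ∷ ⊢L) = ⊢-consequence₂ ⊢φ (⊢⋀ ⊢L) λ _ ⊨φ ⊨L → from ⊨-∧ (⊨φ , ⊨L)

⇔ᶠ-refl : ⊢ (φ ⇔ᶠ φ)
⇔ᶠ-refl = ⊢-tautology λ _ → from ⊨-⇔ ⇔.refl

⇔ᶠ-trans : ⊢ (φ ⇔ᶠ ψ) → ⊢ (ψ ⇔ᶠ χ) → ⊢ (φ ⇔ᶠ χ)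
⇔ᶠ-trans φψ ψχ =
  ⊢-consequence₂ φψ ψχ λ _ ⊨φ⇔ψ ⊨ψ⇔χ → from ⊨-⇔ (⇔.trans (to ⊨-⇔ ⊨φ⇔ψ) (to ⊨-⇔ ⊨ψ⇔χ))

⇔ᶠ-mpʳ : ⊢ (φ ⇔ᶠ ψ) → ⊢ ψ → ⊢ φ
⇔ᶠ-mpʳ φψ ⊢ψ = ⊢-consequence₂ φψ ⊢ψ λ _ ⊨φ⇔ψ → from (to ⊨-⇔ ⊨φ⇔ψ)

-- Reduction to the static fragment

infixr 4 _⇒ᶜ_

_⇒ᶜ_ : Fm k → Ctx → Ctx
φ ⇒ᶜ C = ¬c (∧r φ (¬c C))

∧ᶠ-cong : ⊢ (φ ⇔ᶠ φ′) → ⊢ (ψ ⇔ᶠ ψ′) → ⊢ (φ ∧ᶠ ψ ⇔ᶠ φ′ ∧ᶠ ψ′)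
∧ᶠ-cong {φ′ = φ′} {ψ = ψ} φ⇔φ′ ψ⇔ψ′ =
  ⇔ᶠ-trans (repl (∧l hole ψ) φ⇔φ′) (repl (∧r φ′ hole) ψ⇔ψ′)

Static : Fm k → Set
Static (atm _)   = ⊤
Static (dec _)   = ⊤
Static (¬ᶠ φ)    = Static φ
Static (φ ∧ᶠ ψ)  = Static φ × Static ψ
Static (□I φ)    = Static φ
Static (□F φ)    = Static φ
Static ([ _ ] _) = ⊥

announce : Fm k → Fm k → Fm k
announce χ (atm p)    = □I χ ⇒ atm p
announce χ (dec x)    = □I χ ⇒ dec x
announce χ (¬ᶠ ψ)     = □I χ ⇒ ¬ᶠ announce χ ψ
announce χ (ψ₁ ∧ᶠ ψ₂) = announce χ ψ₁ ∧ᶠ announce χ ψ₂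
announce χ (□I ψ)     = □I χ ⇒ □I (announce χ ψ)
announce χ (□F ψ)     = □I χ ⇒ □F (announce χ ψ)
announce χ ([ φ ] ψ)  = [ χ ] [ φ ] ψ

announce-static : ∀ (χ ψ : Fm k) → Static χ → Static ψ → Static (announce χ ψ)
announce-static χ (atm _)    sχ _          = sχ , tt
announce-static χ (dec _)    sχ _          = sχ , tt
announce-static χ (¬ᶠ ψ)     sχ sψ         = sχ , announce-static χ ψ sχ sψ
announce-static χ (ψ₁ ∧ᶠ ψ₂) sχ (sψ₁ , sψ₂) =
  announce-static χ ψ₁ sχ sψ₁ , announce-static χ ψ₂ sχ sψ₂
announce-static χ (□I ψ)     sχ sψ         = sχ , announce-static χ ψ sχ sψ
announce-static χ (□F ψ)     sχ sψ         = sχ , announce-static χ ψ sχ sψ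

announce-equiv : ∀ (χ ψ : Fm k) → ⊢ ([ χ ] ψ ⇔ᶠ announce χ ψ)
announce-equiv χ (atm p)    = red-atm χ p
announce-equiv χ (dec x)    = red-dec χ x
announce-equiv χ (¬ᶠ ψ)     = ⇔ᶠ-trans (red-¬ χ ψ) (repl (□I χ ⇒ᶜ ¬c hole) (announce-equiv χ ψ))
announce-equiv χ (ψ₁ ∧ᶠ ψ₂) =
  ⇔ᶠ-trans (red-∧ χ ψ₁ ψ₂) (∧ᶠ-cong (announce-equiv χ ψ₁) (announce-equiv χ ψ₂))
announce-equiv χ (□I ψ)     = ⇔ᶠ-trans (red-□I χ ψ) (repl (□I χ ⇒ᶜ □Ic hole) (announce-equiv χ ψ))
announce-equiv χ (□F ψ)     = ⇔ᶠ-trans (red-□F χ ψ) (repl (□I χ ⇒ᶜ □Fc hole) (announce-equiv χ ψ))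
announce-equiv χ ([ _ ] _)  = ⇔ᶠ-refl

toStatic : Fm k → Fm k
toStatic (atm p)   = atm p
toStatic (dec x)   = dec x
toStatic (¬ᶠ φ)    = ¬ᶠ toStatic φ
toStatic (φ ∧ᶠ ψ)  = toStatic φ ∧ᶠ toStatic ψ
toStatic (□I φ)    = □I (toStatic φ)
toStatic (□F φ)    = □F (toStatic φ)
toStatic ([ φ ] ψ) = announce (toStatic φ) (toStatic ψ)

toStatic-static : ∀ (φ : Fm k) → Static (toStatic φ)
toStatic-static (atm _)   = tt
toStatic-static (dec _)   = tt
toStatic-static (¬ᶠ φ)    = toStatic-static φ
toStatic-static (φ ∧ᶠ ψ)  = toStatic-static φ , toStatic-static ψ
toStatic-static (□I φ)    = toStatic-static φ
toStatic-static (□F φ)    = toStatic-static φ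
toStatic-static ([ φ ] ψ) =
  announce-static (toStatic φ) (toStatic ψ) (toStatic-static φ) (toStatic-static ψ)

toStatic-equiv : ∀ (φ : Fm k) → ⊢ (φ ⇔ᶠ toStatic φ)
toStatic-equiv (atm _)   = ⇔ᶠ-refl
toStatic-equiv (dec _)   = ⇔ᶠ-refl
toStatic-equiv (¬ᶠ φ)    = repl (¬c hole) (toStatic-equiv φ)
toStatic-equiv (φ ∧ᶠ ψ)  = ∧ᶠ-cong (toStatic-equiv φ) (toStatic-equiv ψ)
toStatic-equiv (□I φ)    = repl (□Ic hole) (toStatic-equiv φ)
toStatic-equiv (□F φ)    = repl (□Fc hole) (toStatic-equiv φ)
toStatic-equiv ([ φ ] ψ) =
  ⇔ᶠ-trans (repl (annl hole ψ) (toStatic-equiv φ))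
    (⇔ᶠ-trans (repl (annr (toStatic φ) hole) (toStatic-equiv ψ))
      (announce-equiv (toStatic φ) (toStatic ψ)))

Below : ℕ → Fm k → Set
Below N (atm i)   = i < N
Below N (dec _)   = ⊤
Below N (¬ᶠ φ)    = Below N φ
Below N (φ ∧ᶠ ψ)  = Below N φ × Below N ψ
Below N (□I φ)    = Below N φ
Below N (□F φ)    = Below N φ
Below N ([ _ ] _) = ⊥

bound : Fm k → ℕ
bound (atm i)   = suc i
bound (dec _)   = 0
bound (¬ᶠ φ)    = bound φ
bound (φ ∧ᶠ ψ)  = bound φ ⊔ bound ψ
bound (□I φ)    = bound φ
bound (□F φ)    = bound φ
bound ([ _ ] _) = 0

Below-bound : ∀ {N} (φ : Fm k) → Static φ → bound φ ≤ N → Below N φ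
Below-bound (atm _)  _          b≤N = b≤N
Below-bound (dec _)  _          _   = tt
Below-bound (¬ᶠ φ)   sφ         b≤N = Below-bound φ sφ b≤N
Below-bound (φ ∧ᶠ ψ) (sφ , sψ)  b≤N =
  Below-bound φ sφ (≤-trans (m≤m⊔n _ _) b≤N) , Below-bound ψ sψ (≤-trans (m≤n⊔m _ _) b≤N)
Below-bound (□I φ)   sφ         b≤N = Below-bound φ sφ b≤N
Below-bound (□F φ)   sφ         b≤N = Below-bound φ sφ b≤N

Below-static : ∀ {N} (φ : Fm k) → Below N φ → Static φ
Below-static (atm _)  _          = tt
Below-static (dec _)  _          = tt
Below-static (¬ᶠ φ)   bφ         = Below-static φ bφ
Below-static (φ ∧ᶠ ψ) (bφ , bψ)  = Below-static φ bφ , Below-static ψ bψ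
Below-static (□I φ)   bφ         = Below-static φ bφ
Below-static (□F φ)   bφ         = Below-static φ bφ

ClassifierOn : ∀ k → (State → Bool) → Set
ClassifierOn k S = (s : State) → T (S s) → Fin k

sat-Φ-cong : ∀ {S : State → Bool} {Φ₁ Φ₂ : ClassifierOn k S → Set} →
             (∀ f → Φ₁ f ⇔ Φ₂ f) →
             ∀ ψ {s m f} → satSΦ S Φ₁ s m f ψ ⇔ satSΦ S Φ₂ s m f ψ
sat-Φ-cong Φ₁⇔Φ₂ (atm _)   = ⇔.refl
sat-Φ-cong Φ₁⇔Φ₂ (dec _)   = ⇔.refl
sat-Φ-cong Φ₁⇔Φ₂ (¬ᶠ ψ)    = ¬-cong-⇔ (sat-Φ-cong Φ₁⇔Φ₂ ψ)
sat-Φ-cong Φ₁⇔Φ₂ (ψ ∧ᶠ χ)  = sat-Φ-cong Φ₁⇔Φ₂ ψ ×-⇔ sat-Φ-cong Φ₁⇔Φ₂ χ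
sat-Φ-cong Φ₁⇔Φ₂ (□I ψ)    = Π-⇔ λ _ → Π-⇔ λ _ → sat-Φ-cong Φ₁⇔Φ₂ ψ
sat-Φ-cong Φ₁⇔Φ₂ (□F ψ)    = Π-⇔ λ f → →-cong-⇔ (Φ₁⇔Φ₂ f) (sat-Φ-cong Φ₁⇔Φ₂ ψ)
sat-Φ-cong Φ₁⇔Φ₂ ([ φ ] ψ) =
  →-cong-⇔ (announced _) (sat-Φ-cong (λ f → Φ₁⇔Φ₂ f ×-⇔ announced f) ψ)
  where announced = λ f → Π-⇔ λ _ → Π-⇔ λ _ → sat-Φ-cong Φ₁⇔Φ₂ φ {f = f}

sat-plug-cong : (∀ (Γ : MCM k) s m f → MCM.Φ Γ f → sat Γ s m f φ₁ ⇔ sat Γ s m f φ₂) →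
                ∀ C (Γ : MCM k) s m f → MCM.Φ Γ f →
                sat Γ s m f (plug C φ₁) ⇔ sat Γ s m f (plug C φ₂)
sat-plug-cong φ₁⇔φ₂ hole Γ s m f f∈Φ = φ₁⇔φ₂ Γ s m f f∈Φ
sat-plug-cong φ₁⇔φ₂ (¬c C) Γ s m f f∈Φ = ¬-cong-⇔ (sat-plug-cong φ₁⇔φ₂ C Γ s m f f∈Φ)
sat-plug-cong φ₁⇔φ₂ (∧l C _) Γ s m f f∈Φ = sat-plug-cong φ₁⇔φ₂ C Γ s m f f∈Φ ×-⇔ ⇔.refl
sat-plug-cong φ₁⇔φ₂ (∧r _ C) Γ s m f f∈Φ = ⇔.refl ×-⇔ sat-plug-cong φ₁⇔φ₂ C Γ s m f f∈Φ
sat-plug-cong φ₁⇔φ₂ (□Ic C) Γ s m f f∈Φ =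
  Π-⇔ λ s′ → Π-⇔ λ m′ → sat-plug-cong φ₁⇔φ₂ C Γ s′ m′ f f∈Φ
sat-plug-cong φ₁⇔φ₂ (□Fc C) Γ s m f f∈Φ =
  Π-⇔ λ f′ → Π-⇔ λ f′∈Φ → sat-plug-cong φ₁⇔φ₂ C Γ s m f′ f′∈Φ
sat-plug-cong φ₁⇔φ₂ (annr χ C) Γ s m f f∈Φ =
  Π-⇔ λ □χ → sat-plug-cong φ₁⇔φ₂ C (update Γ χ) s m f (f∈Φ , □χ)
sat-plug-cong {φ₁ = φ₁} {φ₂ = φ₂} φ₁⇔φ₂ (annl C ψ) Γ s m f f∈Φ =
  →-cong-⇔ (announced f f∈Φ) (sat-Φ-cong (λ f′ → mk⇔
    (λ (f′∈Φ , □Cφ₁) → f′∈Φ , to (announced f′ f′∈Φ) □Cφ₁)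
    (λ (f′∈Φ , □Cφ₂) → f′∈Φ , from (announced f′ f′∈Φ) □Cφ₂)) ψ)
  where
  announced : ∀ f → MCM.Φ Γ f → _
  announced f f∈Φ = Π-⇔ λ s′ → Π-⇔ λ m′ → sat-plug-cong φ₁⇔φ₂ C Γ s′ m′ f f∈Φ

sat-classifier-cong : ∀ {S : State → Bool} {Φ} {f f′ : ClassifierOn k S} → (∀ s m → f s m ≡ f′ s m) →
                      ∀ ψ → Static ψ → ∀ {s m} → satSΦ S Φ s m f ψ ⇔ satSΦ S Φ s m f′ ψ
sat-classifier-cong f≗f′ (atm _)  _         = ⇔.refl
sat-classifier-cong f≗f′ (dec _)  _ {s} {m} = mk⇔ (trans (sym (f≗f′ s m))) (trans (f≗f′ s m))
sat-classifier-cong f≗f′ (¬ᶠ ψ)   sψ        = ¬-cong-⇔ (sat-classifier-cong f≗f′ ψ sψ)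
sat-classifier-cong f≗f′ (ψ ∧ᶠ χ) (sψ , sχ) =
  sat-classifier-cong f≗f′ ψ sψ ×-⇔ sat-classifier-cong f≗f′ χ sχ
sat-classifier-cong f≗f′ (□I ψ)   sψ        = Π-⇔ λ _ → Π-⇔ λ _ → sat-classifier-cong f≗f′ ψ sψ
sat-classifier-cong f≗f′ (□F ψ)   _         = ⇔.refl

module Classical (lem : ExcludedMiddle 0ℓ) where

  ⇒-intro : (A → B) → ¬ (A × ¬ B)
  ⇒-intro f (a , ¬b) = ¬b (f a)

  ⇒-elim : ¬ (A × ¬ B) → A → B
  ⇒-elim ¬[a∧¬b] a = decidable-stable lem λ ¬b → ¬[a∧¬b] (a , ¬b)

  holds : Set → Bool
  holds A = does (lem {A})

  T-holds : T (holds A) ⇔ A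
  T-holds {A} with lem {A}
  ... | yes a = mk⇔ (λ _ → a) (λ _ → tt)
  ... | no ¬a = mk⇔ (λ ()) ¬a

  holds-cong : A ⇔ B → holds A ≡ holds B
  holds-cong A⇔B = does-⇔ A⇔B lem lem

module Soundness (lem : ExcludedMiddle 0ℓ) where
  open Classical lem

  sat-tautology : ∀ {S Φ s m f} → Tautology φ → satSΦ {k} S Φ s m f φ
  sat-tautology {φ = φ} {S} {Φ} {s} {m} {f} taut-φ =
    to (⊨-faithful respects (λ _ → T-holds) φ) (⊨-intro (from T-≡ (taut-φ _)))
    where
    respects : RespectsConnectives (satSΦ S Φ s m f)
    respects = record { ¬-respected = ⇔.refl ; ∧-respected = ⇔.refl }

  sat-⋁ : ∀ {S Φ s m f} (xs : List (Fin k)) → f s m ∈ xs →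
          satSΦ S Φ s m f (foldr (λ x φ → dec x ∨ᶠ φ) ⊥ᶠ xs)
  sat-⋁ (x ∷ xs) (here fsm≡x)  (fsm≢x , _) = fsm≢x fsm≡x
  sat-⋁ (x ∷ xs) (there fsm∈xs) (_ , ⊭xs)  = ⊭xs (sat-⋁ xs fsm∈xs)

  soundness : ⊢ φ → Valid φ
  soundness (taut t)          Γ s m f f∈Φ = sat-tautology t
  soundness (mp ⊢φ ⊢φ⇒ψ)      Γ s m f f∈Φ =
    ⇒-elim (soundness ⊢φ⇒ψ Γ s m f f∈Φ) (soundness ⊢φ Γ s m f f∈Φ)
  soundness (K-I φ ψ)         Γ s m f f∈Φ =
    ⇒-intro λ (□φ , □φ⇒ψ) s′ m′ → ⇒-elim (□φ⇒ψ s′ m′) (□φ s′ m′)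
  soundness (T-I φ)           Γ s m f f∈Φ = ⇒-intro λ □φ → □φ s m
  soundness (4-I φ)           Γ s m f f∈Φ = ⇒-intro λ □φ _ _ → □φ
  soundness (5-I φ)           Γ s m f f∈Φ = ⇒-intro λ ¬□φ _ _ → ¬□φ
  soundness (nec-I ⊢φ)        Γ s m f f∈Φ = λ s′ m′ → soundness ⊢φ Γ s′ m′ f f∈Φ
  soundness (K-F φ ψ)         Γ s m f f∈Φ =
    ⇒-intro λ (□φ , □φ⇒ψ) f′ f′∈Φ → ⇒-elim (□φ⇒ψ f′ f′∈Φ) (□φ f′ f′∈Φ)
  soundness (T-F φ)           Γ s m f f∈Φ = ⇒-intro λ □φ → □φ f f∈Φ
  soundness (4-F φ)           Γ s m f f∈Φ = ⇒-intro λ □φ _ _ → □φ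
  soundness (5-F φ)           Γ s m f f∈Φ = ⇒-intro λ ¬□φ _ _ → ¬□φ
  soundness (nec-F ⊢φ)        Γ s m f f∈Φ = λ f′ f′∈Φ → soundness ⊢φ Γ s m f′ f′∈Φ
  soundness (comm φ)          Γ s m f f∈Φ =
    ⇒-intro (λ □□φ s′ m′ f′ f′∈Φ → □□φ f′ f′∈Φ s′ m′) ,
    ⇒-intro (λ □□φ f′ f′∈Φ s′ m′ → □□φ s′ m′ f′ f′∈Φ)
  soundness atleast           Γ s m f f∈Φ = sat-⋁ (allFin _) (∈-allFin (f s m))
  soundness (atmost x y x≢y)  Γ s m f f∈Φ = ⇒-intro λ fsm≡x fsm≡y → x≢y (trans (sym fsm≡x) fsm≡y)
  soundness (indep+ p)        Γ s m f f∈Φ = ⇒-intro λ sp _ _ → sp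
  soundness (indep- p)        Γ s m f f∈Φ = ⇒-intro λ ¬sp _ _ → ¬sp
  soundness (red-atm φ p)     Γ s m f f∈Φ = ⇒-intro ⇒-intro , ⇒-intro ⇒-elim
  soundness (red-dec φ x)     Γ s m f f∈Φ = ⇒-intro ⇒-intro , ⇒-intro ⇒-elim
  soundness (red-¬ φ ψ)       Γ s m f f∈Φ =
    ⇒-intro (λ ann¬ψ → ⇒-intro λ □φ annψ → ann¬ψ □φ (annψ □φ)) ,
    ⇒-intro (λ □φ⇒¬annψ □φ ψ′ → ⇒-elim □φ⇒¬annψ □φ λ _ → ψ′)
  soundness (red-∧ φ ψ₁ ψ₂)   Γ s m f f∈Φ =
    ⇒-intro (λ ann → (λ □φ → proj₁ (ann □φ)) , (λ □φ → proj₂ (ann □φ))) ,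
    ⇒-intro (λ (ann₁ , ann₂) □φ → ann₁ □φ , ann₂ □φ)
  soundness (red-□I φ ψ)      Γ s m f f∈Φ =
    ⇒-intro (λ ann → ⇒-intro λ □φ s′ m′ _ → ann □φ s′ m′) ,
    ⇒-intro (λ □φ⇒□ann □φ s′ m′ → ⇒-elim □φ⇒□ann □φ s′ m′ □φ)
  soundness (red-□F φ ψ)      Γ s m f f∈Φ =
    ⇒-intro (λ ann → ⇒-intro λ □φ f′ f′∈Φ □φ′ → ann □φ f′ (f′∈Φ , □φ′)) ,
    ⇒-intro (λ □φ⇒□ann □φ f′ (f′∈Φ , □φ′) → ⇒-elim □φ⇒□ann □φ f′ f′∈Φ □φ′)
  soundness (repl C ⊢φ₁⇔φ₂)   Γ s m f f∈Φ = ⇒-intro (to e) , ⇒-intro (from e)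
    where
    e = sat-plug-cong (λ Γ′ s′ m′ f′ f′∈Φ′ → let (l , r) = soundness ⊢φ₁⇔φ₂ Γ′ s′ m′ f′ f′∈Φ′
                                              in mk⇔ (⇒-elim l) (⇒-elim r)) C Γ s m f f∈Φ

-- Enumerating formulas

triangle : ℕ → ℕ
triangle zero    = zero
triangle (suc d) = suc (triangle d + d)

pair : ℕ → ℕ → ℕ
pair a b = triangle (a + b) + b

unpair : ℕ → ℕ × ℕ
unpair zero    = 0 , 0
unpair (suc n) with unpair n
... | zero  , b = suc b , 0
... | suc a , b = a , suc b

unpair-triangle : ∀ d a b → a + b ≡ d → unpair (triangle d + b) ≡ (a , b)
unpair-triangle zero    zero    zero    refl = refl
unpair-triangle (suc d) a       zero    a≡d+1
  rewrite +-identityʳ (triangle d + d) | +-identityʳ a | a≡d+1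
        | unpair-triangle d 0 d refl = refl
unpair-triangle d       a       (suc b) a+b+1≡d
  rewrite +-suc (triangle d) b | unpair-triangle d (suc a) b (trans (sym (+-suc a b)) a+b+1≡d) = refl

unpair-pair : ∀ a b → unpair (pair a b) ≡ (a , b)
unpair-pair a b = unpair-triangle (a + b) a b refl

code : Fm k → ℕ
code (atm p)   = pair 0 p
code (dec x)   = pair 1 (toℕ x)
code (¬ᶠ φ)    = pair 2 (code φ)
code (φ ∧ᶠ ψ)  = pair 3 (pair (code φ) (code ψ))
code (□I φ)    = pair 4 (code φ)
code (□F φ)    = pair 5 (code φ)
code ([ φ ] ψ) = pair 6 (pair (code φ) (code ψ))

height : Fm k → ℕ
height (atm _)   = 0
height (dec _)   = 0
height (¬ᶠ φ)    = suc (height φ)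
height (φ ∧ᶠ ψ)  = suc (height φ ⊔ height ψ)
height (□I φ)    = suc (height φ)
height (□F φ)    = suc (height φ)
height ([ φ ] ψ) = suc (height φ ⊔ height ψ)

-- Decoding needs fuel; codes of values ≥ k and too little fuel give junk.
decision : ℕ → Fm k
decision {k} i with i <? k
... | yes i<k = dec (fromℕ< i<k)
... | no _    = atm 0

decode : ℕ → ℕ → Fm k
node : ℕ → ℕ × ℕ → Fm k
binary : ℕ → (Fm k → Fm k → Fm k) → ℕ × ℕ → Fm k

decode zero    _ = atm 0
decode (suc n) c = node n (unpair c)

node n (0 , p) = atm p
node n (1 , i) = decision i
node n (2 , c) = ¬ᶠ decode n c
node n (3 , c) = binary n _∧ᶠ_ (unpair c)
node n (4 , c) = □I (decode n c)
node n (5 , c) = □F (decode n c)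
node n (_ , c) = binary n [_]_ (unpair c)

binary n op (c₁ , c₂) = op (decode n c₁) (decode n c₂)

decision-toℕ : ∀ (x : Fin k) → decision (toℕ x) ≡ dec x
decision-toℕ {k} x with toℕ x <? k
... | yes x<k = cong dec (fromℕ<-toℕ x x<k)
... | no x≮k  = ⊥-elim (x≮k (toℕ<n x))

decode-code : ∀ (φ : Fm k) {n} → height φ < n → decode n (code φ) ≡ φ
decode-binary : ∀ {n} {op : Fm k → Fm k → Fm k} φ ψ → height φ ⊔ height ψ < n →
                binary n op (unpair (pair (code φ) (code ψ))) ≡ op φ ψ

decode-code (atm p)   {suc n} _ = cong (node n) (unpair-pair 0 p)
decode-code (dec x)   {suc n} _ = trans (cong (node n) (unpair-pair 1 (toℕ x))) (decision-toℕ x)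
decode-code (¬ᶠ φ)    {suc n} (s≤s h<n) =
  trans (cong (node n) (unpair-pair 2 (code φ))) (cong ¬ᶠ_ (decode-code φ h<n))
decode-code (φ ∧ᶠ ψ)  {suc n} (s≤s h<n) =
  trans (cong (node n) (unpair-pair 3 (pair (code φ) (code ψ)))) (decode-binary {op = _∧ᶠ_} φ ψ h<n)
decode-code (□I φ)    {suc n} (s≤s h<n) =
  trans (cong (node n) (unpair-pair 4 (code φ))) (cong □I (decode-code φ h<n))
decode-code (□F φ)    {suc n} (s≤s h<n) =
  trans (cong (node n) (unpair-pair 5 (code φ))) (cong □F (decode-code φ h<n))
decode-code ([ φ ] ψ) {suc n} (s≤s h<n) =
  trans (cong (node n) (unpair-pair 6 (pair (code φ) (code ψ)))) (decode-binary {op = [_]_} φ ψ h<n)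

decode-binary {op = op} φ ψ h<n rewrite unpair-pair (code φ) (code ψ) =
  cong₂ op (decode-code φ (≤-<-trans (m≤m⊔n _ _) h<n)) (decode-code ψ (≤-<-trans (m≤n⊔m _ _) h<n))

enum : ℕ → Fm k
enum i = let (fuel , c) = unpair i in decode fuel c

index : Fm k → ℕ
index φ = pair (suc (height φ)) (code φ)

enum-index : ∀ (φ : Fm k) → enum (index φ) ≡ φ
enum-index φ rewrite unpair-pair (suc (height φ)) (code φ) = decode-code φ ≤-refl

-- Maximal consistent sets

World : ℕ → Set
World k = Fm k → Bool

infix 4 _∋_

_∋_ : World k → Fm k → Set
w ∋ φ = T (w φ)

record IsMCS (w : World k) : Set where
  field
    theorems : ⊢ φ → w ∋ φ
    respects : RespectsConnectives (w ∋_)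
  open RespectsConnectives respects public

  ∋⇔⊨ : w ∋ φ ⇔ w ⊨ φ
  ∋⇔⊨ {φ = φ} = ⇔.sym (⊨-faithful respects (λ _ → ⇔.refl) φ)

  ∋-mp : ⊢ (φ ⇒ ψ) → w ∋ φ → w ∋ ψ
  ∋-mp ⊢φ⇒ψ ∋φ = from ∋⇔⊨ (to ⊨-⇒ (to ∋⇔⊨ (theorems ⊢φ⇒ψ)) (to ∋⇔⊨ ∋φ))

  ∋-mp₂ : ⊢ (φ ∧ᶠ ψ ⇒ χ) → w ∋ φ → w ∋ ψ → w ∋ χ
  ∋-mp₂ ⊢φψ⇒χ ∋φ ∋ψ = ∋-mp ⊢φψ⇒χ (from ∧-respected (∋φ , ∋ψ))

∋-≗ : {w w′ : World k} → w ≗ w′ → w ∋ φ ⇔ w′ ∋ φ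
∋-≗ {φ = φ} w≗w′ = mk⇔ (subst T (w≗w′ φ)) (subst T (sym (w≗w′ φ)))

IsMCS-≗ : {w w′ : World k} → w ≗ w′ → IsMCS w → IsMCS w′
IsMCS-≗ w≗w′ M = record
  { theorems = to (∋-≗ w≗w′) ∘ theorems
  ; respects = record
    { ¬-respected = ⇔.trans (⇔.sym (∋-≗ w≗w′)) (⇔.trans ¬-respected (¬-cong-⇔ (∋-≗ w≗w′)))
    ; ∧-respected = ⇔.trans (⇔.sym (∋-≗ w≗w′)) (⇔.trans ∧-respected (∋-≗ w≗w′ ×-⇔ ∋-≗ w≗w′))
    }
  }
  where open IsMCS M

Theory : ℕ → Set₁
Theory k = Fm k → Set

Consistent : Theory k → Set
Consistent Δ = ∀ L → All Δ L → ¬ (⊢ ¬ᶠ ⋀ L)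

Consistent-cong : {Δ Δ′ : Theory k} → (∀ φ → Δ φ ⇔ Δ′ φ) → Consistent Δ ⇔ Consistent Δ′
Consistent-cong Δ⇔Δ′ = mk⇔ (λ c L Δ′L → c L (All.map (from (Δ⇔Δ′ _)) Δ′L))
                           (λ c L ΔL → c L (All.map (to (Δ⇔Δ′ _)) ΔL))

infixl 5 _∪｛_｝

_∪｛_｝ : Theory k → Fm k → Theory k
(Δ ∪｛ ψ ｝) φ = Δ φ ⊎ φ ≡ ψ

∪｛｝-cong : {Δ Δ′ : Theory k} → (∀ φ → Δ φ ⇔ Δ′ φ) → ψ ≡ ψ′ →
            ∀ φ → (Δ ∪｛ ψ ｝) φ ⇔ (Δ′ ∪｛ ψ′ ｝) φ
∪｛｝-cong Δ⇔Δ′ ψ≡ψ′ φ =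
  Δ⇔Δ′ φ ⊎-⇔ mk⇔ (λ φ≡ψ → trans φ≡ψ ψ≡ψ′) (λ φ≡ψ′ → trans φ≡ψ′ (sym ψ≡ψ′))

∪｛｝-split : {Δ : Theory k} → ∀ L → All (Δ ∪｛ ψ ｝) L →
             Σ (List (Fm k)) λ L′ → All Δ L′ × (∀ {P : Fm k → Set} → All P L′ → P ψ → All P L)
∪｛｝-split [] [] = [] , [] , λ _ _ → []
∪｛｝-split (φ ∷ L) (Δφ ∷ ΔL) with ∪｛｝-split L ΔL
... | L′ , ΔL′ , back with Δφ
...   | inj₁ Δφ′  = φ ∷ L′ , Δφ′ ∷ ΔL′ , λ { (Pφ ∷ PL′) Pψ → Pφ ∷ back PL′ Pψ }
...   | inj₂ refl = L′ , ΔL′ , λ PL′ Pψ → Pψ ∷ back PL′ Pψ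

∪｛¬｝-consistent : {Δ : Theory k} → Consistent Δ → ¬ Consistent (Δ ∪｛ ψ ｝) →
                   Consistent (Δ ∪｛ ¬ᶠ ψ ｝)
∪｛¬｝-consistent {ψ = ψ} {Δ} cΔ ¬c[Δ,ψ] L₂ ΔL₂ ⊢¬⋀L₂ = ¬c[Δ,ψ] λ L₁ ΔL₁ ⊢¬⋀L₁ →
  let (L₁′ , ΔL₁′ , back₁) = ∪｛｝-split L₁ ΔL₁
      (L₂′ , ΔL₂′ , back₂) = ∪｛｝-split L₂ ΔL₂
  in cΔ (L₁′ ++ L₂′) (++⁺ ΔL₁′ ΔL₂′) (⊢-consequence₂ ⊢¬⋀L₁ ⊢¬⋀L₂ λ v ⊨¬⋀L₁ ⊨¬⋀L₂ →
       from ⊨-¬ λ ⊨⋀ → let (⊨L₁′ , ⊨L₂′) = ++⁻ L₁′ (to ⊨-⋀ ⊨⋀) in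
       case v ⊨? ψ of λ where
         (yes ⊨ψ) → to ⊨-¬ ⊨¬⋀L₁ (from ⊨-⋀ (back₁ ⊨L₁′ ⊨ψ))
         (no ⊭ψ)  → to ⊨-¬ ⊨¬⋀L₂ (from ⊨-⋀ (back₂ ⊨L₂′ (from ⊨-¬ ⊭ψ))))

conjunctive-consistent : {Δ : Theory k} → Δ ⊤ᶠ → (∀ {φ ψ} → Δ φ → Δ ψ → Δ (φ ∧ᶠ ψ)) →
                         (∀ {φ} → Δ φ → ¬ (⊢ ¬ᶠ φ)) → Consistent Δ
conjunctive-consistent {Δ = Δ} Δ⊤ Δ∧ irrefutable L ΔL = irrefutable (Δ⋀ ΔL)
  where
  Δ⋀ : ∀ {L} → All Δ L → Δ (⋀ L)
  Δ⋀ []         = Δ⊤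
  Δ⋀ (Δφ ∷ ΔL) = Δ∧ Δφ (Δ⋀ ΔL)

choose : Fm k → Dec A → Fm k
choose ψ (yes _) = ψ
choose ψ (no _)  = ¬ᶠ ψ

choose-consistent : {Δ : Theory k} → Consistent Δ → (d : Dec (Consistent (Δ ∪｛ ψ ｝))) →
                    Consistent (Δ ∪｛ choose ψ d ｝)
choose-consistent cΔ (yes c[Δ,ψ]) = c[Δ,ψ]
choose-consistent cΔ (no ¬c[Δ,ψ]) = ∪｛¬｝-consistent cΔ ¬c[Δ,ψ]

choose-sides : ∀ {P : Fm k → Set} (d : Dec A) → P (choose ψ d) → P ψ ⊎ P (¬ᶠ ψ)
choose-sides (yes _) = inj₁
choose-sides (no _)  = inj₂

choose-cong : A ⇔ B → (d : Dec A) (d′ : Dec B) → choose ψ d ≡ choose ψ d′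
choose-cong A⇔B (yes _) (yes _) = refl
choose-cong A⇔B (no _)  (no _)  = refl
choose-cong A⇔B (yes a) (no ¬b) = ⊥-elim (¬b (to A⇔B a))
choose-cong A⇔B (no ¬a) (yes b) = ⊥-elim (¬a (from A⇔B b))

data Modality : Set where
  I F : Modality

other : Modality → Modality
other I = F
other F = I

infix 8 □⟨_⟩_ ◇⟨_⟩_

□⟨_⟩_ : Modality → Fm k → Fm k
□⟨ I ⟩ φ = □I φ
□⟨ F ⟩ φ = □F φ

◇⟨_⟩_ : Modality → Fm k → Fm k
◇⟨ X ⟩ φ = ¬ᶠ □⟨ X ⟩ ¬ᶠ φ

⊢K : ∀ X (φ ψ : Fm k) → ⊢ (□⟨ X ⟩ φ ∧ᶠ □⟨ X ⟩ (φ ⇒ ψ) ⇒ □⟨ X ⟩ ψ)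
⊢K I = K-I
⊢K F = K-F

⊢T : ∀ X (φ : Fm k) → ⊢ (□⟨ X ⟩ φ ⇒ φ)
⊢T I = T-I
⊢T F = T-F

⊢4 : ∀ X (φ : Fm k) → ⊢ (□⟨ X ⟩ φ ⇒ □⟨ X ⟩ □⟨ X ⟩ φ)
⊢4 I = 4-I
⊢4 F = 4-F

⊢5 : ∀ X (φ : Fm k) → ⊢ (¬ᶠ □⟨ X ⟩ φ ⇒ □⟨ X ⟩ (¬ᶠ □⟨ X ⟩ φ))
⊢5 I = 5-I
⊢5 F = 5-F

⊢nec : ∀ X → ⊢ φ → ⊢ □⟨ X ⟩ φ
⊢nec I = nec-I
⊢nec F = nec-F

⊢comm : ∀ X (φ : Fm k) → ⊢ (□⟨ X ⟩ □⟨ other X ⟩ φ ⇒ □⟨ other X ⟩ □⟨ X ⟩ φ)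
⊢comm F φ = ⊢-consequence (comm φ) λ _ ⊨⇔ → proj₁ (to ⊨-∧ ⊨⇔)
⊢comm I φ = ⊢-consequence (comm φ) λ _ ⊨⇔ → proj₂ (to ⊨-∧ ⊨⇔)

⊢□-mono : ∀ X → ⊢ (φ ⇒ ψ) → ⊢ (□⟨ X ⟩ φ ⇒ □⟨ X ⟩ ψ)
⊢□-mono X ⊢φ⇒ψ = ⊢-consequence₂ (⊢nec X ⊢φ⇒ψ) (⊢K X _ _) λ _ ⊨□[φ⇒ψ] ⊨K →
  from ⊨-⇒ λ ⊨□φ → to ⊨-⇒ ⊨K (from ⊨-∧ (⊨□φ , ⊨□[φ⇒ψ]))

⊢◇-mono : ∀ X → ⊢ (φ ⇒ ψ) → ⊢ (◇⟨ X ⟩ φ ⇒ ◇⟨ X ⟩ ψ)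
⊢◇-mono X ⊢φ⇒ψ =
  ⊢-consequence (⊢□-mono X (⊢-consequence ⊢φ⇒ψ λ _ ⊨φ⇒ψ →
                  from ⊨-⇒ λ ⊨¬ψ → from ⊨-¬ (to ⊨-¬ ⊨¬ψ ∘ to ⊨-⇒ ⊨φ⇒ψ)))
    λ _ ⊨□¬ψ⇒□¬φ → from ⊨-⇒ λ ⊨◇φ → from ⊨-¬ (to ⊨-¬ ⊨◇φ ∘ to ⊨-⇒ ⊨□¬ψ⇒□¬φ)

⊢◇□⇒ : ∀ X (φ : Fm k) → ⊢ (◇⟨ X ⟩ □⟨ X ⟩ φ ⇒ φ)
⊢◇□⇒ X φ = ⊢-consequence₂ (⊢5 X φ) (⊢T X φ) λ _ ⊨5 ⊨T → from ⊨-⇒ λ ⊨◇□φ →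
  to ⊨-⇒ ⊨T (⊨-stable λ ⊭□φ → to ⊨-¬ ⊨◇□φ (to ⊨-⇒ ⊨5 (from ⊨-¬ ⊭□φ)))

module _ {w : World k} (M : IsMCS w) where
  open IsMCS M

  ∋-stable : ¬ ¬ w ∋ φ → w ∋ φ
  ∋-stable {φ = φ} = decidable-stable (T? (w φ))

  ∋-□-mono : ∀ X → ⊢ (φ ⇒ ψ) → w ∋ □⟨ X ⟩ φ → w ∋ □⟨ X ⟩ ψ
  ∋-□-mono X ⊢φ⇒ψ = ∋-mp (⊢□-mono X ⊢φ⇒ψ)

  ∋-□-∧ : ∀ X → w ∋ □⟨ X ⟩ φ → w ∋ □⟨ X ⟩ ψ → w ∋ □⟨ X ⟩ (φ ∧ᶠ ψ)
  ∋-□-∧ X ∋□φ ∋□ψ =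
    ∋-mp₂ (⊢K X _ _) ∋□ψ
      (∋-□-mono X (⊢-tautology λ _ → from ⊨-⇒ λ ⊨φ → from ⊨-⇒ λ ⊨ψ → from ⊨-∧ (⊨φ , ⊨ψ)) ∋□φ)

  ∋-T : ∀ X → w ∋ □⟨ X ⟩ φ → w ∋ φ
  ∋-T X = ∋-mp (⊢T X _)

infix 4 _~⟨_⟩_

record _~⟨_⟩_ (u : World k) (X : Modality) (w : World k) : Set where
  constructor mk~
  field agree : ∀ φ → u ∋ □⟨ X ⟩ φ ⇔ w ∋ □⟨ X ⟩ φ
open _~⟨_⟩_

~-refl : ∀ {w : World k} {X} → w ~⟨ X ⟩ w
~-refl = mk~ λ _ → ⇔.refl

~-sym : ∀ {u w : World k} {X} → u ~⟨ X ⟩ w → w ~⟨ X ⟩ u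
~-sym u~w = mk~ λ φ → ⇔.sym (agree u~w φ)

~-trans : ∀ {u v w : World k} {X} → u ~⟨ X ⟩ v → v ~⟨ X ⟩ w → u ~⟨ X ⟩ w
~-trans u~v v~w = mk~ λ φ → ⇔.trans (agree u~v φ) (agree v~w φ)

boxes-agree : ∀ {u w : World k} X → IsMCS u → IsMCS w →
              (∀ {α} → u ∋ □⟨ X ⟩ α → w ∋ α) → u ~⟨ X ⟩ w
boxes-agree X Mu Mw □u⊆w = mk~ λ θ → mk⇔
  (λ ∋□θ → □u⊆w (IsMCS.∋-mp Mu (⊢4 X θ) ∋□θ))
  (λ ∋□θ → ∋-stable Mu λ ∌□θ →
    to (IsMCS.¬-respected Mw) (□u⊆w (IsMCS.∋-mp Mu (⊢5 X θ) (from (IsMCS.¬-respected Mu) ∌□θ))) ∋□θ)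

Generated : Modality → World k → Theory k → Theory k
Generated {k} X u C φ = Σ (Fm k) λ α → Σ (Fm k) λ χ → u ∋ □⟨ X ⟩ α × C χ × (⊢ (α ∧ᶠ χ ⇒ φ))

Directed : Theory k → Set
Directed {k} C =
  Σ (Fm k) C × (∀ {χ₁ χ₂} → C χ₁ → C χ₂ → Σ (Fm k) λ χ → C χ × (⊢ (χ ⇒ χ₁ ∧ᶠ χ₂)))

module _ {u : World k} {C : Theory k} (X : Modality) (Mu : IsMCS u) (dir : Directed C) where
  open IsMCS Mu

  private
    ∋□⊤ : u ∋ □⟨ X ⟩ ⊤ᶠ
    ∋□⊤ = theorems (⊢nec X (⊢-tautology λ _ → ⊨-⊤))

  Generated-boxes : ∀ {α} → u ∋ □⟨ X ⟩ α → Generated X u C α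
  Generated-boxes ∋□α = _ , _ , ∋□α , proj₂ (proj₁ dir) , ⊢-tautology λ _ → from ⊨-⇒ (proj₁ ∘ to ⊨-∧)

  Generated-⊇ : ∀ {χ} → C χ → Generated X u C χ
  Generated-⊇ Cχ = ⊤ᶠ , _ , ∋□⊤ , Cχ , ⊢-tautology λ _ → from ⊨-⇒ (proj₂ ∘ to ⊨-∧)

  Generated-consistent : (∀ {α χ} → u ∋ □⟨ X ⟩ α → C χ → ¬ (⊢ ¬ᶠ (α ∧ᶠ χ))) →
                         Consistent (Generated X u C)
  Generated-consistent irrefutable = conjunctive-consistent
    (⊤ᶠ , _ , ∋□⊤ , proj₂ (proj₁ dir) , ⊢-tautology λ _ → from ⊨-⇒ λ _ → ⊨-⊤)
    (λ (α₁ , χ₁ , ∋□α₁ , Cχ₁ , ⊢₁) (α₂ , χ₂ , ∋□α₂ , Cχ₂ , ⊢₂) →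
      let (χ , Cχ , ⊢χ⇒χ₁χ₂) = proj₂ dir Cχ₁ Cχ₂
      in α₁ ∧ᶠ α₂ , χ , ∋-□-∧ Mu X ∋□α₁ ∋□α₂ , Cχ , ⊢-consequences (⊢₁ ∷ ⊢₂ ∷ ⊢χ⇒χ₁χ₂ ∷ [])
           λ { _ (⊨₁ ∷ ⊨₂ ∷ ⊨χ⇒χ₁χ₂ ∷ []) → from ⊨-⇒ λ ⊨α₁α₂χ →
                 let (⊨α₁α₂ , ⊨χ) = to ⊨-∧ ⊨α₁α₂χ
                     (⊨α₁ , ⊨α₂) = to ⊨-∧ ⊨α₁α₂
                     (⊨χ₁ , ⊨χ₂) = to ⊨-∧ (to ⊨-⇒ ⊨χ⇒χ₁χ₂ ⊨χ)
                 in from ⊨-∧ ( to ⊨-⇒ ⊨₁ (from ⊨-∧ (⊨α₁ , ⊨χ₁))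
                            , to ⊨-⇒ ⊨₂ (from ⊨-∧ (⊨α₂ , ⊨χ₂))) })
    (λ (α , χ , ∋□α , Cχ , ⊢αχ⇒φ) ⊢¬φ → irrefutable ∋□α Cχ
      (⊢-consequence₂ ⊢αχ⇒φ ⊢¬φ λ _ ⊨⇒ ⊨¬φ → from ⊨-¬ (to ⊨-¬ ⊨¬φ ∘ to ⊨-⇒ ⊨⇒)))

~F-atoms : ∀ {u w : World k} {i} → IsMCS u → IsMCS w → u ~⟨ F ⟩ w → u ∋ atm i ⇔ w ∋ atm i
~F-atoms {i = i} Mu Mw u~w = mk⇔
  (λ ∋p → ∋-T Mw F (to (agree u~w (atm i)) (IsMCS.∋-mp Mu (indep+ i) ∋p)))
  (λ ∋p → ∋-stable Mu λ ∌p → to (IsMCS.¬-respected Mw)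
    (∋-T Mw F (to (agree u~w (¬ᶠ atm i)) (IsMCS.∋-mp Mu (indep- i) (from (IsMCS.¬-respected Mu) ∌p)))) ∋p)

~-cong : ∀ {a a′ c : World k} {X} → a ≗ a′ → a ~⟨ X ⟩ c ⇔ a′ ~⟨ X ⟩ c
~-cong a≗a′ = mk⇔ (λ a~c → mk~ λ φ → ⇔.trans (⇔.sym (∋-≗ a≗a′)) (agree a~c φ))
                  (λ a′~c → mk~ λ φ → ⇔.trans (∋-≗ a≗a′) (agree a′~c φ))

Diamonds : Modality → World k → Theory k
Diamonds {k} Y c χ = Σ (Fm k) λ β → c ∋ β × χ ≡ ◇⟨ Y ⟩ β

Diamonds-directed : ∀ {c : World k} Y → IsMCS c → Directed (Diamonds Y c)
Diamonds-directed Y Mc =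
  (◇⟨ Y ⟩ ⊤ᶠ , ⊤ᶠ , IsMCS.theorems Mc (⊢-tautology λ _ → ⊨-⊤) , refl) ,
  λ { (β₁ , ∋β₁ , refl) (β₂ , ∋β₂ , refl) →
        ◇⟨ Y ⟩ (β₁ ∧ᶠ β₂) , (β₁ ∧ᶠ β₂ , from (IsMCS.∧-respected Mc) (∋β₁ , ∋β₂) , refl) ,
        ⊢-consequence₂ (⊢◇-mono Y (⊢-tautology λ _ → from ⊨-⇒ (proj₁ ∘ to ⊨-∧)))
                       (⊢◇-mono Y (⊢-tautology λ _ → from ⊨-⇒ (proj₂ ∘ to ⊨-∧)))
          λ _ ⊨₁ ⊨₂ → from ⊨-⇒ λ ⊨◇ → from ⊨-∧ (to ⊨-⇒ ⊨₁ ⊨◇ , to ⊨-⇒ ⊨₂ ⊨◇) }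

first : World k → Fin k → List (Fin k) → Fin k
first w x₀ []       = x₀
first w x₀ (x ∷ xs) = if w (dec x) then x else first w x₀ xs

first-∋ : ∀ {w : World k} {x₀} xs → Any (λ x → w ∋ dec x) xs → w ∋ dec (first w x₀ xs)
first-∋ {w = w} {x₀} (x ∷ xs) ∋xs = if-dec (λ y → w ∋ dec y) (T? (w (dec x))) id λ ∌x →
  first-∋ {w = w} {x₀} xs (case ∋xs of λ { (here ∋x) → ⊥-elim (∌x ∋x) ; (there ∋xs′) → ∋xs′ })

first-cong : ∀ {w w′ : World k} {x₀} xs → w ≗ w′ → first w x₀ xs ≡ first w′ x₀ xs
first-cong []       _     = refl
first-cong (x ∷ xs) w≗w′ = cong₂ (λ b y → if b then x else y) (w≗w′ (dec x)) (first-cong xs w≗w′)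

output : Fin k → World k → Fin k
output {k} x₀ w = first w x₀ (allFin k)

∋-some-output : ∀ {w : World k} → IsMCS w → Any (λ x → w ∋ dec x) (allFin k)
∋-some-output M = Any.map ⊨-elim (⊨-⋁ (allFin _) (to (IsMCS.∋⇔⊨ M) (IsMCS.theorems M atleast)))

output-spec : ∀ {w : World k} {x₀ x} → IsMCS w → output x₀ w ≡ x ⇔ w ∋ dec x
output-spec {k} {w} {x₀} M = mk⇔ (λ { refl → ∋output }) (λ ∋x → unique ∋output ∋x)
  where
  open IsMCS M
  ∋output = first-∋ {w = w} {x₀} (allFin k) (∋-some-output M)
  unique : ∀ {x y} → w ∋ dec x → w ∋ dec y → x ≡ y
  unique {x} {y} ∋x ∋y with x Fin.≟ y
  ... | yes x≡y = x≡y
  ... | no x≢y  = ⊥-elim (to ¬-respected (∋-mp (atmost x y x≢y) ∋x) ∋y)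

module Completeness (lem : ExcludedMiddle 0ℓ) where
  open Classical lem

  maximal-IsMCS : {G : Theory k} → Consistent G → (∀ φ → G φ ⊎ G (¬ᶠ φ)) →
                  IsMCS (λ φ → holds (G φ))
  maximal-IsMCS {G = G} cG complete = record
    { theorems = λ ⊢φ → from T-holds (closed [] [] (⊢-consequence ⊢φ λ _ ⊨φ → from ⊨-⇒ λ _ → ⊨φ))
    ; respects = record
      { ¬-respected = ⇔.trans T-holds (⇔.trans G¬ (¬-cong-⇔ (⇔.sym T-holds)))
      ; ∧-respected = ⇔.trans T-holds (⇔.trans G∧ (⇔.sym T-holds ×-⇔ ⇔.sym T-holds))
      }
    }
    where
    closed : ∀ {φ} L → All G L → ⊢ (⋀ L ⇒ φ) → G φ
    closed {φ} L GL ⊢⋀L⇒φ with complete φ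
    ... | inj₁ Gφ  = Gφ
    ... | inj₂ G¬φ = ⊥-elim (cG (¬ᶠ φ ∷ L) (G¬φ ∷ GL) (⊢-consequence ⊢⋀L⇒φ λ v ⊨⋀L⇒φ →
                       from ⊨-¬ λ ⊨¬φ∧⋀L → let (⊨¬φ , ⊨⋀L) = to ⊨-∧ ⊨¬φ∧⋀L
                                           in to ⊨-¬ ⊨¬φ (to ⊨-⇒ ⊨⋀L⇒φ ⊨⋀L)))
    closed-by : ∀ {φ} L → All G L → (∀ v → All (v ⊨_) L → v ⊨ φ) → G φ
    closed-by L GL L⊨φ = closed L GL (⊢-tautology λ v → from ⊨-⇒ (L⊨φ v ∘ to ⊨-⋀))
    G¬ : ∀ {φ} → G (¬ᶠ φ) ⇔ (¬ G φ)
    G¬ {φ} = mk⇔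
      (λ G¬φ Gφ → cG (φ ∷ ¬ᶠ φ ∷ []) (Gφ ∷ G¬φ ∷ []) (⊢-tautology λ v → from ⊨-¬ λ ⊨⋀ →
        case to ⊨-⋀ ⊨⋀ of λ { (⊨φ ∷ ⊨¬φ ∷ []) → to ⊨-¬ ⊨¬φ ⊨φ }))
      (λ ¬Gφ → case complete φ of λ { (inj₁ Gφ) → ⊥-elim (¬Gφ Gφ) ; (inj₂ G¬φ) → G¬φ })
    G∧ : ∀ {φ ψ} → G (φ ∧ᶠ ψ) ⇔ (G φ × G ψ)
    G∧ = mk⇔
      (λ Gφψ → closed-by (_ ∷ []) (Gφψ ∷ []) (λ { v (⊨φψ ∷ []) → proj₁ (to ⊨-∧ ⊨φψ) })
             , closed-by (_ ∷ []) (Gφψ ∷ []) (λ { v (⊨φψ ∷ []) → proj₂ (to ⊨-∧ ⊨φψ) }))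
      (λ (Gφ , Gψ) → closed-by (_ ∷ _ ∷ []) (Gφ ∷ Gψ ∷ [])
        λ { v (⊨φ ∷ ⊨ψ ∷ []) → from ⊨-∧ (⊨φ , ⊨ψ) })

  module Lindenbaum {k : ℕ} (Δ : Theory k) where

    stage : ℕ → Theory k
    stage zero    = Δ
    stage (suc n) = stage n ∪｛ choose (enum n) (lem {Consistent (stage n ∪｛ enum n ｝)}) ｝

    Limit : Theory k
    Limit φ = Σ ℕ λ n → stage n φ

    lindenbaum : World k
    lindenbaum φ = holds (Limit φ)

    stage-consistent : Consistent Δ → ∀ n → Consistent (stage n)
    stage-consistent cΔ zero    = cΔ
    stage-consistent cΔ (suc n) = choose-consistent (stage-consistent cΔ n) lem

    stage-⊆ : ∀ d {n φ} → stage n φ → stage (d + n) φ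
    stage-⊆ zero    = id
    stage-⊆ (suc d) = inj₁ ∘ stage-⊆ d

    gather : ∀ L → All Limit L → Σ ℕ λ n → All (stage n) L
    gather []      []                    = 0 , []
    gather (φ ∷ L) ((n₁ , φ∈) ∷ L∈) with gather L L∈
    ... | n₂ , L∈ₙ₂ = n₂ + n₁ , stage-⊆ n₂ φ∈ ∷
                      All.map (λ {ψ} ψ∈ → subst (λ n → stage n ψ) (+-comm n₁ n₂) (stage-⊆ n₁ ψ∈)) L∈ₙ₂

    Limit-consistent : Consistent Δ → Consistent Limit
    Limit-consistent cΔ L L∈ = let (n , L∈ₙ) = gather L L∈ in stage-consistent cΔ n L L∈ₙ

    Limit-complete : ∀ φ → Limit φ ⊎ Limit (¬ᶠ φ)
    Limit-complete φ = subst (λ ψ → Limit ψ ⊎ Limit (¬ᶠ ψ)) (enum-index φ)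
                         (choose-sides {P = Limit} lem (suc (index φ) , inj₂ refl))

    lindenbaum-IsMCS : Consistent Δ → IsMCS lindenbaum
    lindenbaum-IsMCS cΔ = maximal-IsMCS (Limit-consistent cΔ) Limit-complete

    lindenbaum-⊇ : ∀ {φ} → Δ φ → lindenbaum ∋ φ
    lindenbaum-⊇ Δφ = from T-holds (0 , Δφ)

  open Lindenbaum using (lindenbaum; lindenbaum-IsMCS; lindenbaum-⊇)

  lindenbaum-cong : {Δ Δ′ : Theory k} → (∀ φ → Δ φ ⇔ Δ′ φ) → lindenbaum Δ ≗ lindenbaum Δ′
  lindenbaum-cong {Δ = Δ} {Δ′} Δ⇔Δ′ φ =
    holds-cong (mk⇔ (λ (n , x) → n , to (stage-cong n φ) x) (λ (n , x) → n , from (stage-cong n φ) x))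
    where
    open Lindenbaum using (stage)
    stage-cong : ∀ n φ → stage Δ n φ ⇔ stage Δ′ n φ
    stage-cong zero    = Δ⇔Δ′
    stage-cong (suc n) = ∪｛｝-cong (stage-cong n)
      (choose-cong (Consistent-cong (∪｛｝-cong (stage-cong n) refl)) lem lem)

  ∋-□-intro : ∀ {u : World k} {ψ} X → IsMCS u →
              (∀ {w} → IsMCS w → u ~⟨ X ⟩ w → w ∋ ψ) → u ∋ □⟨ X ⟩ ψ
  ∋-□-intro {k} {u} {ψ} X Mu neighbours⊨ψ = ∋-stable Mu λ ∌□ψ →
    to (IsMCS.¬-respected (Mw ∌□ψ)) (lindenbaum-⊇ Δ (Generated-⊇ X Mu dir refl))
      (neighbours⊨ψ (Mw ∌□ψ) (boxes-agree X Mu (Mw ∌□ψ) (lindenbaum-⊇ Δ ∘ Generated-boxes X Mu dir)))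
    where
    dir : Directed (_≡ ¬ᶠ ψ)
    dir = (¬ᶠ ψ , refl) , λ { refl refl →
      ¬ᶠ ψ , refl , ⊢-tautology λ _ → from ⊨-⇒ λ ⊨¬ψ → from ⊨-∧ (⊨¬ψ , ⊨¬ψ) }
    Δ = Generated X u (_≡ ¬ᶠ ψ)
    Mw : ¬ u ∋ □⟨ X ⟩ ψ → IsMCS (lindenbaum Δ)
    Mw ∌□ψ = lindenbaum-IsMCS Δ (Generated-consistent X Mu dir λ { ∋□α refl ⊢¬[α∧¬ψ] →
      ∌□ψ (∋-□-mono Mu X (⊢-consequence ⊢¬[α∧¬ψ] λ _ ⊨¬[α∧¬ψ] → from ⊨-⇒ λ ⊨α →
        ⊨-stable λ ⊭ψ → to ⊨-¬ ⊨¬[α∧¬ψ] (from ⊨-∧ (⊨α , from ⊨-¬ ⊭ψ))) ∋□α) })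

  -- Church–Rosser for the two commuting equivalences.
  bridge : Modality → World k → World k → World k
  bridge X u c = lindenbaum (Generated X u (Diamonds (other X) c))

  bridge-spec : ∀ {u v c : World k} X → IsMCS u → IsMCS v → IsMCS c →
                u ~⟨ other X ⟩ v → v ~⟨ X ⟩ c →
                IsMCS (bridge X u c) × u ~⟨ X ⟩ bridge X u c × bridge X u c ~⟨ other X ⟩ c
  bridge-spec {u = u} {v} {c} X Mu Mv Mc u~v v~c =
    Mw , boxes-agree X Mu Mw (lindenbaum-⊇ Δ ∘ Generated-boxes X Mu dir) ,
    ~-sym (boxes-agree Y Mc Mw λ {α} ∋□α →
      IsMCS.∋-mp Mw (⊢◇□⇒ Y α) (lindenbaum-⊇ Δ (Generated-⊇ X Mu dir (_ , ∋□α , refl))))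
    where
    Y = other X
    dir = Diamonds-directed Y Mc
    Δ = Generated X u (Diamonds Y c)
    Mw = lindenbaum-IsMCS Δ (Generated-consistent X Mu dir λ { {α} ∋□α (β , ∋β , refl) ⊢¬[α∧◇β] →
           let ⊢α⇒□¬β = ⊢-consequence ⊢¬[α∧◇β] λ _ ⊨¬[α∧◇β] → from ⊨-⇒ λ ⊨α →
                          ⊨-stable λ ⊭□¬β → to ⊨-¬ ⊨¬[α∧◇β] (from ⊨-∧ (⊨α , from ⊨-¬ ⊭□¬β))
               u∋□Y□X¬β = IsMCS.∋-mp Mu (⊢comm X (¬ᶠ β)) (∋-□-mono Mu X ⊢α⇒□¬β ∋□α)
               c∋□X¬β = to (agree v~c (¬ᶠ β)) (∋-T Mv Y (to (agree u~v (□⟨ X ⟩ ¬ᶠ β)) u∋□Y□X¬β))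
           in to (IsMCS.¬-respected Mc) (∋-T Mc X c∋□X¬β) ∋β })

  bridge-cong : ∀ {u u′ c : World k} X → u ≗ u′ → bridge X u c ≗ bridge X u′ c
  bridge-cong X u≗u′ = lindenbaum-cong λ φ → mk⇔
    (λ (α , χ , ∋□α , Cχ , ⊢⇒) → α , χ , subst T (u≗u′ (□⟨ X ⟩ α)) ∋□α , Cχ , ⊢⇒)
    (λ (α , χ , ∋□α , Cχ , ⊢⇒) → α , χ , subst T (sym (u≗u′ (□⟨ X ⟩ α))) ∋□α , Cχ , ⊢⇒)

  -- The canonical model around a maximal consistent set w₀

  module Canonical {k : ℕ} {w₀ : World k} (M₀ : IsMCS w₀) (N : ℕ) where

    record Reachable (w : World k) : Set where
      field
        mcs     : IsMCS w
        hub     : World k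
        hub-mcs : IsMCS hub
        w₀~hub  : w₀ ~⟨ I ⟩ hub
        hub~w   : hub ~⟨ F ⟩ w
    open Reachable

    w₀-reachable : Reachable w₀
    w₀-reachable = record { mcs = M₀ ; hub = w₀ ; hub-mcs = M₀ ; w₀~hub = ~-refl ; hub~w = ~-refl }

    Reachable-~F : ∀ {a w} → Reachable a → IsMCS w → a ~⟨ F ⟩ w → Reachable w
    Reachable-~F Ra Mw a~w = record
      { mcs = Mw ; hub = hub Ra ; hub-mcs = hub-mcs Ra ; w₀~hub = w₀~hub Ra ; hub~w = ~-trans (hub~w Ra) a~w }

    Reachable-~I : ∀ {c w} → Reachable c → IsMCS w → c ~⟨ I ⟩ w → Reachable w
    Reachable-~I Rc Mw c~w =
      let (Mb , hub~b , b~w) = bridge-spec I (hub-mcs Rc) (mcs Rc) Mw (hub~w Rc) c~w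
      in record { mcs = Mw ; hub = _ ; hub-mcs = Mb ; w₀~hub = ~-trans (w₀~hub Rc) hub~b ; hub~w = b~w }

    Reachable-≗ : ∀ {w w′} → w ≗ w′ → Reachable w → Reachable w′
    Reachable-≗ w≗w′ Rw = Reachable-~F Rw (IsMCS-≗ w≗w′ (mcs Rw)) (mk~ λ _ → ∋-≗ w≗w′)

    meet : World k → World k → World k
    meet = bridge F

    meet-spec : ∀ {a c} → Reachable a → Reachable c →
                IsMCS (meet a c) × a ~⟨ F ⟩ meet a c × meet a c ~⟨ I ⟩ c
    meet-spec Ra Rc =
      let (Mb , a~b , b~hub) = bridge-spec I (mcs Ra) (hub-mcs Ra) (hub-mcs Rc)
                                 (~-sym (hub~w Ra)) (~-trans (~-sym (w₀~hub Ra)) (w₀~hub Rc))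
      in bridge-spec F (mcs Ra) Mb (mcs Rc) a~b (~-trans b~hub (hub~w Rc))

    -- The world seen from a state storing (a , b) by a classifier storing
    -- (c , b′).  Equal bits favour c, so that a classifier can reach every
    -- F-neighbour of a; different bits favour a, so that a state can reach
    -- every I-neighbour of c.
    cell : World k → Bool → World k → Bool → World k
    cell a b c b′ = if does (b ≟ b′) then (if holds (a ~⟨ F ⟩ c) then c else meet a c)
                                      else (if holds (a ~⟨ I ⟩ c) then a else meet a c)

    cell-spec : ∀ {a b c b′} → Reachable a → Reachable c →
                IsMCS (cell a b c b′) × a ~⟨ F ⟩ cell a b c b′ × cell a b c b′ ~⟨ I ⟩ c
    cell-spec {a} {b} {c} {b′} Ra Rc =
      if-dec R (b ≟ b′) (λ _ → if-dec R lem (λ a~c → mcs Rc , a~c , ~-refl) λ _ → meet-spec Ra Rc)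
                        (λ _ → if-dec R lem (λ a~c → mcs Ra , ~-refl , a~c) λ _ → meet-spec Ra Rc)
      where R = λ w → IsMCS w × a ~⟨ F ⟩ w × w ~⟨ I ⟩ c

    cell-same : ∀ {a b c} → a ~⟨ F ⟩ c → cell a b c b ≡ c
    cell-same {b = b} a~c rewrite dec-true (b ≟ b) refl | dec-true lem a~c = refl

    cell-flip : ∀ {a c b′} → a ~⟨ I ⟩ c → cell a (not b′) c b′ ≡ a
    cell-flip {b′ = b′} a~c rewrite dec-false (not b′ ≟ b′) (not-¬ refl ∘ sym) | dec-true lem a~c = refl

    cell-cong : ∀ {a a′ b b″ c b′} → a ≗ a′ → b ≡ b″ → cell a b c b′ ≗ cell a′ b″ c b′
    cell-cong {b = b} {c = c} {b′} a≗a′ refl = if-cong {b = does (b ≟ b′)} refl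
      (if-cong (holds-cong (~-cong {c = c} {X = F} a≗a′)) (λ _ → refl) (bridge-cong F a≗a′))
      (if-cong (holds-cong (~-cong {c = c} {X = I} a≗a′)) a≗a′ (bridge-cong F a≗a′))

    -- Atoms below N are read off the stored world; the atoms from N on
    -- serve as storage for a bit and for the world itself.
    storage : State → ℕ → Bool
    storage s j = s (N + j)

    stateBit : State → Bool
    stateBit s = storage s 0

    stateWorld : State → World k
    stateWorld s φ = storage s (suc (index φ))

    stored : World k → Bool → ℕ → Bool
    stored a b zero    = b
    stored a b (suc j) = a (enum j)

    encode : World k → Bool → State
    encode a b i = if i <ᵇ N then a (atm i) else stored a b (i ∸ N)

    encode-storage : ∀ a b j → storage (encode a b) j ≡ stored a b j
    encode-storage a b j
      rewrite to T-not-≡ (from T-not λ N+j<N → <⇒≱ (<ᵇ⇒< (N + j) N N+j<N) (m≤m+n N j))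
            | m+n∸m≡n N j = refl

    stateWorld-encode : ∀ a b → stateWorld (encode a b) ≗ a
    stateWorld-encode a b φ = trans (encode-storage a b (suc (index φ))) (cong a (enum-index φ))

    stateBit-encode : ∀ a b → stateBit (encode a b) ≡ b
    stateBit-encode a b = encode-storage a b 0

    encode-below : ∀ a b {i} → i < N → encode a b i ≡ a (atm i)
    encode-below a b i<N rewrite to T-≡ (<⇒<ᵇ i<N) = refl

    ValidState : State → Set
    ValidState s = Reachable (stateWorld s) × (∀ i → i < N → s i ≡ stateWorld s (atm i))

    encode-valid : ∀ {a} b → Reachable a → ValidState (encode a b)
    encode-valid {a} b Ra = Reachable-≗ (sym ∘ stateWorld-encode a b) Ra ,
                            λ i i<N → trans (encode-below a b i<N) (sym (stateWorld-encode a b (atm i)))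

    S : State → Bool
    S s = holds (ValidState s)

    x₀ : Fin k
    x₀ = proj₁ (Any.satisfied (∋-some-output M₀))

    cellOf : State → World k → Bool → World k
    cellOf s = cell (stateWorld s) (stateBit s)

    classify : World k → Bool → ClassifierOn k S
    classify c b′ s _ = output x₀ (cellOf s c b′)

    Φ : ClassifierOn k S → Set
    Φ f = Σ (World k) λ c → Σ Bool λ b′ → Reachable c × (∀ s m → f s m ≡ classify c b′ s m)

    model : MCM k
    model = record
      { S   = S
      ; Φ   = Φ
      ; ext = λ f (c , b′ , _ , f≗) s s′ m m′ s≗s′ → trans (f≗ s m) (trans
                (first-cong (allFin k) (cell-cong {c = c} {b′ = b′} (λ _ → s≗s′ _) (s≗s′ _)))
                (sym (f≗ s′ m′)))
      }

    cellOf-spec : ∀ {s c b′} → T (S s) → Reachable c →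
                  IsMCS (cellOf s c b′) × stateWorld s ~⟨ F ⟩ cellOf s c b′ × cellOf s c b′ ~⟨ I ⟩ c
    cellOf-spec {s} {b′ = b′} m Rc = cell-spec {b = stateBit s} {b′ = b′} (proj₁ (to T-holds m)) Rc

    cellOf-mcs : ∀ {s c b′} → T (S s) → Reachable c → IsMCS (cellOf s c b′)
    cellOf-mcs m Rc = proj₁ (cellOf-spec m Rc)

    column-~I : ∀ {s s′ c b′} → T (S s) → T (S s′) → Reachable c →
                cellOf s c b′ ~⟨ I ⟩ cellOf s′ c b′
    column-~I m m′ Rc = ~-trans (proj₂ (proj₂ (cellOf-spec m Rc))) (~-sym (proj₂ (proj₂ (cellOf-spec m′ Rc))))

    row-~F : ∀ {s c c′ b′ b″} → T (S s) → Reachable c → Reachable c′ →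
             cellOf s c b′ ~⟨ F ⟩ cellOf s c′ b″
    row-~F m Rc Rc′ = ~-trans (~-sym (proj₁ (proj₂ (cellOf-spec m Rc)))) (proj₁ (proj₂ (cellOf-spec m Rc′)))

    cellOf-encode : ∀ a b {c b′} → cellOf (encode a b) c b′ ≗ cell a b c b′
    cellOf-encode a b = cell-cong (stateWorld-encode a b) (stateBit-encode a b)

    column-covers : ∀ {c w ψ} b′ → Reachable c → IsMCS w → w ~⟨ I ⟩ c →
                    (∀ {s} → T (S s) → cellOf s c b′ ∋ ψ) → w ∋ ψ
    column-covers {c} {w} {ψ} b′ Rc Mw w~c column⊨ψ =
      subst T (trans (cellOf-encode w (not b′) ψ) (cong-app (cell-flip {b′ = b′} w~c) ψ))
        (column⊨ψ (from T-holds (encode-valid (not b′) (Reachable-~I Rc Mw (~-sym w~c)))))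

    row-covers : ∀ {s w ψ} → T (S s) → IsMCS w → stateWorld s ~⟨ F ⟩ w →
                 (∀ {c b′} → Reachable c → cellOf s c b′ ∋ ψ) → w ∋ ψ
    row-covers {s} {w} {ψ} m Mw s~w row⊨ψ =
      subst (_∋ ψ) (cell-same {b = stateBit s} s~w)
        (row⊨ψ {w} {stateBit s} (Reachable-~F (proj₁ (to T-holds m)) Mw s~w))

    _,_,_⊩_ : ∀ {s} → T (S s) → World k → Bool → Fm k → Set
    _,_,_⊩_ {s} m c b′ ψ = satSΦ S Φ s m (classify c b′) ψ

    atom-truth : ∀ {s} (m : T (S s)) {c b′ i} → Reachable c → i < N →
                 (s i ≡ true) ⇔ cellOf s c b′ ∋ atm i
    atom-truth m {i = i} Rc i<N =
      ⇔.trans (⇔.sym T-≡) (⇔.trans (mk⇔ (subst T (atoms i i<N)) (subst T (sym (atoms i i<N))))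
                                    (~F-atoms (mcs Rs) (cellOf-mcs m Rc) (proj₁ (proj₂ (cellOf-spec m Rc)))))
      where
      Rs = proj₁ (to T-holds m)
      atoms = proj₂ (to T-holds m)

    □I-truth : ∀ {s} (m : T (S s)) {c b′ ψ} → Reachable c →
               (∀ {s} (m : T (S s)) → m , c , b′ ⊩ ψ ⇔ cellOf s c b′ ∋ ψ) →
               m , c , b′ ⊩ □I ψ ⇔ cellOf s c b′ ∋ □I ψ
    □I-truth m {c} {b′} {ψ} Rc truthψ = mk⇔
      (λ ⊩□ψ → ∋-□-intro I (cellOf-mcs m Rc) λ Mw cell~w →
        column-covers b′ Rc Mw (~-trans (~-sym cell~w) (proj₂ (proj₂ (cellOf-spec m Rc))))
          λ m′ → to (truthψ m′) (⊩□ψ _ m′))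
      (λ ∋□ψ s′ m′ → from (truthψ m′) (∋-T (cellOf-mcs m′ Rc) I (to (agree (column-~I m m′ Rc) ψ) ∋□ψ)))

    □F-truth : ∀ {s} (m : T (S s)) {c b′ ψ} → Reachable c → Static ψ →
               (∀ {c b′} → Reachable c → m , c , b′ ⊩ ψ ⇔ cellOf s c b′ ∋ ψ) →
               m , c , b′ ⊩ □F ψ ⇔ cellOf s c b′ ∋ □F ψ
    □F-truth m {c} {b′} {ψ} Rc sψ truthψ = mk⇔
      (λ ⊩□ψ → ∋-□-intro F (cellOf-mcs m Rc) λ Mw cell~w →
        row-covers m Mw (~-trans (proj₁ (proj₂ (cellOf-spec m Rc))) cell~w)
          λ Rc′ → to (truthψ Rc′) (⊩□ψ _ (_ , _ , Rc′ , λ _ _ → refl)))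
      (λ ∋□ψ f (c′ , b″ , Rc′ , f≗) → from (sat-classifier-cong f≗ ψ sψ) (from (truthψ Rc′)
        (∋-T (cellOf-mcs m Rc′) F (to (agree (row-~F m Rc Rc′) ψ) ∋□ψ))))

    truth : ∀ ψ → Below N ψ → ∀ {s} (m : T (S s)) {c} b′ → Reachable c →
            m , c , b′ ⊩ ψ ⇔ cellOf s c b′ ∋ ψ
    truth (atm i)  i<N       m b′ Rc = atom-truth m Rc i<N
    truth (dec x)  _         m b′ Rc = output-spec (cellOf-mcs m Rc)
    truth (¬ᶠ ψ)   bψ        m b′ Rc =
      ⇔.trans (¬-cong-⇔ (truth ψ bψ m b′ Rc)) (⇔.sym (IsMCS.¬-respected (cellOf-mcs m Rc)))
    truth (ψ ∧ᶠ χ) (bψ , bχ) m b′ Rc =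
      ⇔.trans (truth ψ bψ m b′ Rc ×-⇔ truth χ bχ m b′ Rc) (⇔.sym (IsMCS.∧-respected (cellOf-mcs m Rc)))
    truth (□I ψ)   bψ        m b′ Rc = □I-truth m Rc λ m′ → truth ψ bψ m′ b′ Rc
    truth (□F ψ)   bψ        m b′ Rc =
      □F-truth m Rc (Below-static ψ bψ) λ {_} {b″} Rc′ → truth ψ bψ m b″ Rc′

    refutes : ∀ {ψ} → Below N ψ → ¬ w₀ ∋ ψ → ¬ Valid ψ
    refutes {ψ} bψ ∌ψ valid = ∌ψ (row-covers m₀ M₀ s₀~w₀ λ {c} {b′} Rc →
      to (truth ψ bψ m₀ b′ Rc) (valid model s₀ m₀ _ (c , b′ , Rc , λ _ _ → refl)))
      where
      s₀ = encode w₀ true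
      m₀ = from T-holds (encode-valid true w₀-reachable)
      s₀~w₀ = mk~ λ _ → ∋-≗ (stateWorld-encode w₀ true)

  open Soundness lem

  static-completeness : ∀ {ψ : Fm k} → Static ψ → Valid ψ → ⊢ ψ
  static-completeness {k} {ψ} sψ valid = decidable-stable lem λ ⊬ψ →
    Canonical.refutes (lindenbaum-IsMCS Δ (consistent ⊬ψ)) (bound ψ) (Below-bound ψ sψ ≤-refl)
      (to (IsMCS.¬-respected (lindenbaum-IsMCS Δ (consistent ⊬ψ))) (lindenbaum-⊇ Δ refl)) valid
    where
    Δ : Theory k
    Δ = _≡ ¬ᶠ ψ
    consistent : ¬ (⊢ ψ) → Consistent Δ
    consistent ⊬ψ L L≡¬ψ ⊢¬⋀L = ⊬ψ (⊢-consequence ⊢¬⋀L λ _ ⊨¬⋀L → ⊨-stable λ ⊭ψ →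
      to ⊨-¬ ⊨¬⋀L (from ⊨-⋀ (All.map (λ { refl → from ⊨-¬ ⊭ψ }) L≡¬ψ)))

  completeness : Valid φ → ⊢ φ
  completeness {φ = φ} valid = ⇔ᶠ-mpʳ (toStatic-equiv φ) (static-completeness (toStatic-static φ)
    λ Γ s m f f∈Φ → ⇒-elim (proj₁ (soundness (toStatic-equiv φ) Γ s m f f∈Φ)) (valid Γ s m f f∈Φ))

theorem9 : (lem : ∀ {ℓ} → ExcludedMiddle ℓ) (k : ℕ) (φ : Fm k) →
           (⊢ φ) ⇔ Valid φ
theorem9 lem k φ = mk⇔ soundness completeness
  where
  open Soundness lem
  open Completeness lem
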